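{- Let $G$ be an MP-digraph and $e$ an edge of $G$. If $e$ is a loop of $M_G$, then $T_{M_G}(x,y)=y\,T_{M_{G\setminus e}}(x,y)$. If $e$ is a coloop of $M_G$, then $T_{M_G}(x,y)=x\,T_{M_{G/\!\!/e}}(x,y)$. If $e$ is neither a loop nor a coloop of $M_G$, then $T_{M_G}(x,y)=T_{M_{G\setminus e}}(x,y)+T_{M_{G/\!\!/e}}(x,y)$.
   Context: Digraphs: finite, at most one edge $(v,w)$ from $v$ to $w$ for distinct $v,w$, finitely many loops allowed per vertex. A multipath is a spanning subgraph each of whose connected components is a vertex or a simple path (sequence of non-loop edges, target of each = source of next, no repeated vertex, not closing into a cycle); $M_G=(E(G),\mathrm{Mult}(G))$. An MP-digraph satisfies (MP1) no subgraph isomorphic to $D_A$ (vertices $v_0,v_1,v_2$, edges $(v_1,v_0),(v_0,v_2),(v_1,v_2)$) or $D_B$ (vertices $v_0,\dots,v_3$, edges $(v_0,v_1),(v_2,v_1),(v_2,v_3)$) or their edge-reversals, and (MP2) every coherently oriented cycle of length $\ge2$ is a connected component; then $M_G$ is a matroid. An element $e$ is a loop of a matroid if $\{e\}$ is dependent, and a coloop if it lies in every basis (maximal independent set); the loops of $M_G$ are exactly the loops of $G$. $G\setminus e$ deletes edge $e$. For a non-loop edge $e=(v,w)$, the MP-contraction $G/\!\!/e$ has vertices $(V(G)\setminus\{v,w\})\cup\{x\}$; edges $(a,b)$ with $a,b\notin\{v,w\}$ kept; $(a,v)\mapsto(a,x)$, $(w,b)\mapsto(x,b)$; each $(v,a)$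 with $a\ne w$ and each $(b,w)$ with $b\ne v$ becomes a loop at $x$; loops at $v,w$ (and an edge $(w,v)$, if present) become loops at $x$. Tutte polynomial: $T_M(x,y)=\sum_{A\subseteq X}(x-1)^{r(X)-r(A)}(y-1)^{|A|-r(A)}$, $r$ the rank function. -}

module Defs where

open import Data.Bool using (Bool; true; false; _∧_; not; if_then_else_; T)
open import Data.Nat using (ℕ; zero; suc; _∸_; _⊔_)
open import Data.Fin using (Fin; zero; suc; toℕ; punchIn; punchOut; lower₁)
open import Data.Fin.Properties using (_≟_)
open import Data.Fin.Subset using (Subset; ∣_∣; _∈_; _⊆_; ⁅_⁆)
open import Data.Vec using (Vec; []; _∷_; lookup)
open import Data.List using (List; []; _∷_; map; _++_; allFin; foldr; filterᵇ)
open import Data.Maybe using (Maybe; just; nothing; is-nothing)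
open import Data.Integer using (ℤ; _+_; _*_; _-_; _^_; +_)
open import Data.Product using (Σ; ∃; _×_; _,_)
open import Data.Sum using (_⊎_)
open import Relation.Nullary using (¬_; yes; no)
open import Relation.Nullary.Decidable using (⌊_⌋)
open import Relation.Binary.PropositionalEquality using (_≡_; _≢_)

-- Arbitrary (finitely many) loops per vertex are allowed; the
-- "at most one edge (v,w) for distinct v,w" condition is the predicate
-- `Simple` below (it is part of the hypotheses via `IsMPDigraph`).

record Digraph (V E : ℕ) : Set where
  field
    src tgt : Fin E → Fin V
open Digraph public

module _ {V E : ℕ} (G : Digraph V E) where

  Simple : Set
  Simple = (e f : Fin E) → src G e ≢ tgt G e →
           src G e ≡ src G f → tgt G e ≡ tgt G f → e ≡ f

  HasEdge : Fin V → Fin V → Set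
  HasEdge a b = ∃ λ e → src G e ≡ a × tgt G e ≡ b

  ContainsDA : Set
  ContainsDA = Σ (Fin V) λ v0 → Σ (Fin V) λ v1 → Σ (Fin V) λ v2 →
    v0 ≢ v1 × v0 ≢ v2 × v1 ≢ v2 ×
    HasEdge v1 v0 × HasEdge v0 v2 × HasEdge v1 v2

  ContainsDAʳ : Set
  ContainsDAʳ = Σ (Fin V) λ v0 → Σ (Fin V) λ v1 → Σ (Fin V) λ v2 →
    v0 ≢ v1 × v0 ≢ v2 × v1 ≢ v2 ×
    HasEdge v0 v1 × HasEdge v2 v0 × HasEdge v2 v1

  ContainsDB : Set
  ContainsDB = Σ (Fin V) λ v0 → Σ (Fin V) λ v1 → Σ (Fin V) λ v2 → Σ (Fin V) λ v3 →
    v0 ≢ v1 × v0 ≢ v2 × v0 ≢ v3 × v1 ≢ v2 × v1 ≢ v3 × v2 ≢ v3 ×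
    HasEdge v0 v1 × HasEdge v2 v1 × HasEdge v2 v3

  ContainsDBʳ : Set
  ContainsDBʳ = Σ (Fin V) λ v0 → Σ (Fin V) λ v1 → Σ (Fin V) λ v2 → Σ (Fin V) λ v3 →
    v0 ≢ v1 × v0 ≢ v2 × v0 ≢ v3 × v1 ≢ v2 × v1 ≢ v3 × v2 ≢ v3 ×
    HasEdge v1 v0 × HasEdge v1 v2 × HasEdge v3 v2

  MP1 : Set
  MP1 = ¬ ContainsDA × ¬ ContainsDAʳ × ¬ ContainsDB × ¬ ContainsDBʳ

cyc : ∀ {n} → Fin (suc n) → Fin (suc n)
cyc {n} i with n Data.Nat.≟ toℕ i
... | yes _ = zero
... | no n≢i = suc (lower₁ i n≢i)

module _ {V E : ℕ} (G : Digraph V E) where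

  IsDirCycle : (k : ℕ) → (Fin (suc (suc k)) → Fin V) → Set
  IsDirCycle k u = ((i j : Fin (suc (suc k))) → u i ≡ u j → i ≡ j) ×
                   ((i : Fin (suc (suc k))) → HasEdge G (u i) (u (cyc i)))

  -- The cycle is a connected component: every edge of G having an
  -- endpoint on the cycle is one of the cycle edges u i → u (i+1).
  IsComponentCycle : (k : ℕ) → (Fin (suc (suc k)) → Fin V) → Set
  IsComponentCycle k u =
    (f : Fin E) →
    ((∃ λ i → src G f ≡ u i) ⊎ (∃ λ i → tgt G f ≡ u i)) →
    ∃ λ i → src G f ≡ u i × tgt G f ≡ u (cyc i)

  MP2 : Set
  MP2 = (k : ℕ) (u : Fin (suc (suc k)) → Fin V) →
        IsDirCycle k u → IsComponentCycle k u

  IsMPDigraph : Set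
  IsMPDigraph = Simple G × MP1 G × MP2

-- An edge set B (a subset of Fin E) spans a multipath iff
-- every component of (V, B) is a single vertex or a simple directed path,
-- i.e. iff B contains no loop, no two edges of B share a source, no two
-- edges of B share a target, and (V, B) has no directed cycle.
-- Under the degree conditions, (V,B) has no directed cycle iff following
-- the (unique) outgoing B-edge V times from any vertex always stops.

allᵇ : ∀ {A : Set} → (A → Bool) → List A → Bool
allᵇ p = foldr (λ a r → p a ∧ r) true

module _ {V E : ℕ} (G : Digraph V E) where

  _==_ : ∀ {n} → Fin n → Fin n → Bool
  a == b = ⌊ a ≟ b ⌋

  nextB : Subset E → Fin V → Maybe (Fin V)
  nextB B v = foldr (λ e r → if lookup B e ∧ (src G e == v) then just (tgt G e) else r)
                    nothing (allFin E)

  walk : Subset E → ℕ → Maybe (Fin V) → Maybe (Fin V)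
  walk B zero    m = m
  walk B (suc n) nothing  = nothing
  walk B (suc n) (just v) = walk B n (nextB B v)

  isMultipath : Subset E → Bool
  isMultipath B =
    allᵇ (λ e → not (lookup B e) ∨' not (src G e == tgt G e)) (allFin E) ∧
    allᵇ (λ e → allᵇ (λ f → not (lookup B e ∧ lookup B f) ∨' (e == f) ∨'
                          (not (src G e == src G f) ∧ not (tgt G e == tgt G f)))
                   (allFin E)) (allFin E) ∧
    allᵇ (λ v → is-nothing (walk B V (just v))) (allFin V)
    where
      _∨'_ : Bool → Bool → Bool
      true  ∨' _ = true
      false ∨' b = b
      infixr 5 _∨'_

subsets : (n : ℕ) → List (Subset n)
subsets zero    = [] ∷ []
subsets (suc n) = map (true ∷_) (subsets n) ++ map (false ∷_) (subsets n)

_⊆ᵇ_ : ∀ {n} → Subset n → Subset n → Bool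
[]      ⊆ᵇ []      = true
(a ∷ A) ⊆ᵇ (b ∷ B) = (if a then b else true) ∧ (A ⊆ᵇ B)

module _ {n : ℕ} (indep : Subset n → Bool) where

  rank : Subset n → ℕ
  rank A = foldr (λ B r → ∣ B ∣ ⊔ r) 0
                 (filterᵇ (λ B → indep B ∧ (B ⊆ᵇ A)) (subsets n))

  tutte : ℤ → ℤ → ℤ
  tutte x y = foldr (λ A s → ((x - + 1) ^ (rank (Data.Vec.replicate n true) ∸ rank A))
                             * ((y - + 1) ^ (∣ A ∣ ∸ rank A)) + s)
                    (+ 0) (subsets n)

  Independent : Subset n → Set
  Independent B = T (indep B)

  IsBasis : Subset n → Set
  IsBasis B = Independent B × ((B' : Subset n) → Independent B' → B ⊆ B' → B' ≡ B)

  IsMatroidLoop : Fin n → Set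
  IsMatroidLoop e = ¬ Independent ⁅ e ⁆

  IsMatroidColoop : Fin n → Set
  IsMatroidColoop e = (B : Subset n) → IsBasis B → e ∈ B

M : ∀ {V E} → Digraph V E → Subset E → Bool
M G = isMultipath G

T_M : ∀ {V E} → Digraph V E → ℤ → ℤ → ℤ
T_M G = tutte (M G)

delete : ∀ {V E} → Digraph V (suc E) → Fin (suc E) → Digraph V E
delete G e = record { src = λ f → src G (punchIn e f) ; tgt = λ f → tgt G (punchIn e f) }

-- Vertices: Fin V, obtained from Fin (suc V) by identifying v and w into
-- the new vertex x (the image of v and of w) and removing w.
-- Each edge f ≠ e with endpoints (a,b):
--   if a ≡ v or b ≡ w, it becomes a loop at x
--     (this covers (v,a), (b,w), loops at v or w, and e's parallel/reverse
--      configurations, e.g. (w,v) gives (x,x) anyway);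
--   otherwise it becomes (c a, c b), where c is the identification map
--     (so (a,b) ↦ (a,b), (a,v) ↦ (a,x), (w,b) ↦ (x,b), (w,v) ↦ (x,x)).
module _ {V E : ℕ} (G : Digraph (suc V) (suc E)) (e : Fin (suc E))
         (nl : src G e ≢ tgt G e) where

  private
    v w : Fin (suc V)
    v = src G e
    w = tgt G e

  mergeVertex : Fin (suc V) → Fin V
  mergeVertex u with w ≟ u
  ... | yes _   = punchOut {i = w} {j = v} (λ p → nl (Relation.Binary.PropositionalEquality.sym p))
  ... | no w≢u  = punchOut {i = w} {j = u} w≢u

  xVertex : Fin V
  xVertex = mergeVertex v

  private
    edgeEnds : Fin (suc E) → Fin V × Fin V
    edgeEnds f with src G f ≟ v | tgt G f ≟ w
    ... | yes _ | _     = xVertex , xVertex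
    ... | no _  | yes _ = xVertex , xVertex
    ... | no _  | no _  = mergeVertex (src G f) , mergeVertex (tgt G f)

  contract : Digraph V E
  contract = record { src = λ f → Data.Product.proj₁ (edgeEnds (punchIn e f))
                    ; tgt = λ f → Data.Product.proj₂ (edgeEnds (punchIn e f)) }

{-# OPTIONS --safe #-}
-- Splitting the Tutte sum of M_G according to whether a subset contains e leaves two sums over the
-- subsets A of the remaining edges, so the three identities reduce to rank identities: r(A) equals
-- the rank of A in G∖e, and r(A + e) = 1 + (rank of A in G//e) when e is not a loop; besides,
-- r(A + e) = r(A) for a loop, r(A + e) = 1 + r(A) for a coloop, and r(E) = r(E − e) otherwise.
-- The multipaths of G∖e are those of G avoiding e, and B is a multipath of G//e exactly when B + e
-- is one of G. What matroid theory would add is exchange: a multipath avoiding the non-loop e can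
-- be traded for one containing e that is no smaller, and, when some basis avoids e, a multipath
-- containing e for one avoiding it. Each trade removes one edge and adds another; (MP1) excludes
-- the configurations D_A, D_B that would block it, and (MP2), applied to the cycle formed by a
-- path of a multipath and the added edge, pins down every other edge at that path.
module Submission where

open import Defs
open import Data.Bool using (Bool; true; false; T; _∧_; if_then_else_)
open import Data.Bool.Properties using (T-∧; T-≡)
open import Data.Empty using (⊥-elim)
open import Data.Fin using (Fin; zero; suc; toℕ; punchIn; punchOut; fromℕ<)
open import Data.Fin.Properties
  using (_≟_; suc-injective; punchIn-injective; punchInᵢ≢i; punchIn-punchOut; punchOut-punchIn;
         punchOut-cong; toℕ<n; toℕ-injective; toℕ-lower₁; toℕ-fromℕ<; any?; all?; ¬∀⟶∃¬; pigeonhole)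
open import Data.Fin.Subset using (Subset; _∈_; _∉_; _⊆_; _⊃_; ∣_∣; ⊥; ⊤; ⁅_⁆; _∪_; _─_)
open import Data.Fin.Subset.Induction using (⊃-wellFounded; Acc; acc)
open import Data.Fin.Subset.Properties
  using (_∈?_; ∈⊤; ∉⊥; x∈⁅x⁆; x∈⁅y⁆⇒x≡y; x∈p∪q⁺; x∈p∪q⁻; ∪-identityʳ; p─⊥≡p;
         drop-∷-⊆; ⊆-refl; ⊆-antisym; ⊆-min; ⊆⊤; ∣⊥∣≡0; ∣p∣≤∣p∪q∣; p⊆q⇒∣p∣≤∣q∣)
open import Data.List using (List; []; _∷_; _++_; map; foldr; filterᵇ; allFin)
open import Data.List.Membership.Propositional using () renaming (_∈_ to _∈ˡ_)
open import Data.List.Membership.Propositional.Properties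
  using (∈-++⁺ˡ; ∈-++⁺ʳ; ∈-map⁺; ∈-filter⁺; ∈-filter⁻; ∈-allFin)
open import Data.List.Relation.Unary.Any using (here; there)
open import Data.Maybe using (Maybe; just; nothing; is-nothing; fromMaybe)
open import Data.Maybe.Properties using (just-injective)
import Data.Maybe.Properties as Maybe
open import Data.Nat using (ℕ; zero; suc; _∸_; _⊔_; _≤_; _<_; z≤n; s≤s)
import Data.Nat.Properties as ℕ
open import Data.Product using (∃; ∃₂; _×_; _,_; proj₁; proj₂)
open import Data.Sum using (_⊎_; inj₁; inj₂)
open import Data.Vec using ([]; _∷_; lookup; insertAt; removeAt; here; there)
open import Data.Vec.Properties
  using (insertAt-lookup; insertAt-punchIn; insertAt-removeAt; []=⇒lookup; lookup⇒[]=)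
open import Function using (id; _∘_; _⇔_; mk⇔)
open import Function.Bundles using (module Equivalence)
import Function.Properties.Equivalence as ⇔
open import Relation.Binary.Definitions using (tri<; tri≈; tri>)
open import Relation.Binary.PropositionalEquality
  using (_≡_; _≢_; refl; sym; trans; cong; cong₂; subst; module ≡-Reasoning)
open import Relation.Nullary using (¬_; Dec; yes; no; ¬?; contradiction)
open import Relation.Nullary.Decidable using (T?; _×-dec_)

open Equivalence using (to; from)

private variable
  n : ℕ
  x y : Fin n
  p : Subset n

allᵇ⁻ : ∀ {A : Set} {p : A → Bool} {xs x} → T (allᵇ p xs) → x ∈ˡ xs → T (p x)
allᵇ⁻ ok (here refl)  = proj₁ (T-∧ .to ok)
allᵇ⁻ ok (there x∈xs) = allᵇ⁻ (proj₂ (T-∧ .to ok)) x∈xs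

allᵇ≡false : ∀ {A : Set} {p : A → Bool} xs → allᵇ p xs ≡ false →
             ∃ λ x → x ∈ˡ xs × p x ≡ false
allᵇ≡false {p = p} (x ∷ xs) fails with p x in px
... | false = x , here refl , px
... | true  with allᵇ≡false xs fails
...   | y , y∈ , py = y , there y∈ , py

is-nothing⇒≡nothing : ∀ {A : Set} {m : Maybe A} → T (is-nothing m) → m ≡ nothing
is-nothing⇒≡nothing {m = nothing} _ = refl

∧³≡true : ∀ {a b c} → a ∧ b ∧ c ≡ true → T a × T b × T c
∧³≡true {true} {true} {true} _ = _ , _ , _

∧³≡false : ∀ {a b c} → a ∧ b ∧ c ≡ false → a ≡ false ⊎ b ≡ false ⊎ c ≡ false
∧³≡false {false}               _  = inj₁ refl
∧³≡false {true} {false}        _  = inj₂ (inj₁ refl)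
∧³≡false {true} {true} {false} _  = inj₂ (inj₂ refl)

private
  below-suc : ∀ {P : ℕ → Set} {n i} → P n → (i < n → P i) → i < suc n → P i
  below-suc Pn below i<1+n with ℕ.m<1+n⇒m<n∨m≡n i<1+n
  ... | inj₁ i<n  = below i<n
  ... | inj₂ refl = Pn

last-failure : ∀ {P : ℕ → Set} → (∀ i → Dec (P i)) → ∀ n →
               (∀ {i} → i < n → P i) ⊎ ∃ λ i → i < n × ¬ P i × (∀ {j} → i < j → j < n → P j)
last-failure P? zero = inj₁ λ ()
last-failure P? (suc n) with P? n
... | no ¬Pn = inj₂ (n , ℕ.≤-refl , ¬Pn , λ n<j j<1+n → contradiction (ℕ.≤-pred j<1+n) (ℕ.<⇒≱ n<j))
... | yes Pn with last-failure P? n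
...   | inj₁ below                  = inj₁ (below-suc Pn below)
...   | inj₂ (i , i<n , ¬Pi , later) = inj₂ (i , ℕ.m≤n⇒m≤1+n i<n , ¬Pi , below-suc Pn ∘ later)

∈⇒lookup : x ∈ p → lookup p x ≡ true
∈⇒lookup = []=⇒lookup

lookup⇒∈ : lookup p x ≡ true → x ∈ p
lookup⇒∈ = lookup⇒[]= _ _

∉⇒lookup : x ∉ p → lookup p x ≡ false
∉⇒lookup {x = x} {p} x∉p with lookup p x in eq
... | true  = contradiction (lookup⇒∈ eq) x∉p
... | false = refl

x∈p∧y∉p⇒x≢y : x ∈ p → y ∉ p → x ≢ y
x∈p∧y∉p⇒x≢y x∈p y∉p refl = y∉p x∈p

⁅y⁆⊆q : ∀ {q : Subset n} → y ∈ q → ⁅ y ⁆ ⊆ q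
⁅y⁆⊆q {y = y} {q} y∈q x∈ = subst (_∈ q) (sym (x∈⁅y⁆⇒x≡y y x∈)) y∈q

x∈p∪⁅y⁆⁻ : ∀ (p : Subset n) → x ∈ p ∪ ⁅ y ⁆ → x ≡ y ⊎ x ∈ p
x∈p∪⁅y⁆⁻ {y = y} p x∈ with x∈p∪q⁻ p ⁅ y ⁆ x∈
... | inj₁ x∈p   = inj₂ x∈p
... | inj₂ x∈⁅y⁆ = inj₁ (x∈⁅y⁆⇒x≡y y x∈⁅y⁆)

y∈p∪⁅y⁆ : ∀ (p : Subset n) → y ∈ p ∪ ⁅ y ⁆
y∈p∪⁅y⁆ {y = y} p = x∈p∪q⁺ (inj₂ (x∈⁅x⁆ y))

p⊆p∪⁅y⁆ : ∀ (p : Subset n) → p ⊆ p ∪ ⁅ y ⁆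
p⊆p∪⁅y⁆ p x∈p = x∈p∪q⁺ (inj₁ x∈p)

p∪⁅y⁆⊆q : ∀ {p q : Subset n} → p ⊆ q → y ∈ q → p ∪ ⁅ y ⁆ ⊆ q
p∪⁅y⁆⊆q {p = p} p⊆q y∈q x∈ with x∈p∪⁅y⁆⁻ p x∈
... | inj₁ refl = y∈q
... | inj₂ x∈p  = p⊆q x∈p

∣p∪⁅y⁆∣≡1+∣p∣ : ∀ (p : Subset n) → y ∉ p → ∣ p ∪ ⁅ y ⁆ ∣ ≡ suc ∣ p ∣
∣p∪⁅y⁆∣≡1+∣p∣ {y = zero}  (true ∷ p)  y∉p = contradiction here y∉p
∣p∪⁅y⁆∣≡1+∣p∣ {y = zero}  (false ∷ p) _   = cong suc (cong ∣_∣ (∪-identityʳ p))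
∣p∪⁅y⁆∣≡1+∣p∣ {y = suc y} (true ∷ p)  y∉p = cong suc (∣p∪⁅y⁆∣≡1+∣p∣ p (y∉p ∘ there))
∣p∪⁅y⁆∣≡1+∣p∣ {y = suc y} (false ∷ p) y∉p = ∣p∪⁅y⁆∣≡1+∣p∣ p (y∉p ∘ there)

x∈p─⁅y⁆⁻ : ∀ (p : Subset n) → x ∈ p ─ ⁅ y ⁆ → x ≢ y × x ∈ p
x∈p─⁅y⁆⁻ {x = zero}  {zero}  (true ∷ p) ()
x∈p─⁅y⁆⁻ {x = zero}  {suc y} (true ∷ p) here       = (λ ()) , here
x∈p─⁅y⁆⁻ {x = suc x} {zero}  (b ∷ p)    (there x∈) = (λ ()) , there (subst (x ∈_) (p─⊥≡p p) x∈)
x∈p─⁅y⁆⁻ {x = suc x} {suc y} (b ∷ p)    (there x∈) with x∈p─⁅y⁆⁻ p x∈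
... | x≢y , x∈p = x≢y ∘ suc-injective , there x∈p

1+∣p─⁅y⁆∣≡∣p∣ : ∀ (p : Subset n) → y ∈ p → suc ∣ p ─ ⁅ y ⁆ ∣ ≡ ∣ p ∣
1+∣p─⁅y⁆∣≡∣p∣ {y = zero}  (true ∷ p)  here        = cong suc (cong ∣_∣ (p─⊥≡p p))
1+∣p─⁅y⁆∣≡∣p∣ {y = suc y} (true ∷ p)  (there y∈p) = cong suc (1+∣p─⁅y⁆∣≡∣p∣ p y∈p)
1+∣p─⁅y⁆∣≡∣p∣ {y = suc y} (false ∷ p) (there y∈p) = 1+∣p─⁅y⁆∣≡∣p∣ p y∈p

data InsertView (e : Fin (suc n)) : Fin (suc n) → Set where
  at      : InsertView e e
  punched : ∀ f → InsertView e (punchIn e f)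

insertView : (e x : Fin (suc n)) → InsertView e x
insertView e x with e ≟ x
... | yes refl = at
... | no e≢x   = subst (InsertView e) (punchIn-punchOut e≢x) (punched (punchOut e≢x))

module _ (e : Fin (suc n)) where

  e∈insertAt : ∀ (A : Subset n) → e ∈ insertAt A e true
  e∈insertAt A = lookup⇒∈ (insertAt-lookup A e true)

  e∈insertAt⁻ : ∀ {A : Subset n} {b} → e ∈ insertAt A e b → b ≡ true
  e∈insertAt⁻ {A} {b} e∈ = trans (sym (insertAt-lookup A e b)) (∈⇒lookup e∈)

  e∉insertAt : ∀ (A : Subset n) → e ∉ insertAt A e false
  e∉insertAt A e∈ with e∈insertAt⁻ e∈
  ... | ()

  punchIn∈insertAt⁺ : ∀ {A : Subset n} {f} b → f ∈ A → punchIn e f ∈ insertAt A e b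
  punchIn∈insertAt⁺ {A} {f} b f∈A = lookup⇒∈ (trans (insertAt-punchIn A e b f) (∈⇒lookup f∈A))

  punchIn∈insertAt⁻ : ∀ {A : Subset n} {f} b → punchIn e f ∈ insertAt A e b → f ∈ A
  punchIn∈insertAt⁻ {A} {f} b f∈ = lookup⇒∈ (trans (sym (insertAt-punchIn A e b f)) (∈⇒lookup f∈))

  ∈insertAt-true⁻ : ∀ {A : Subset n} {x} → x ∈ insertAt A e true →
                    x ≡ e ⊎ ∃ λ f → x ≡ punchIn e f × f ∈ A
  ∈insertAt-true⁻ {x = x} x∈ with insertView e x
  ... | at        = inj₁ refl
  ... | punched f = inj₂ (f , refl , punchIn∈insertAt⁻ true x∈)

  ∈insertAt-false⁻ : ∀ {A : Subset n} {x} → x ∈ insertAt A e false →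
                     ∃ λ f → x ≡ punchIn e f × f ∈ A
  ∈insertAt-false⁻ {A} {x} x∈ with insertView e x
  ... | at        = contradiction x∈ (e∉insertAt A)
  ... | punched f = f , refl , punchIn∈insertAt⁻ false x∈

  insertAt-mono : ∀ {B A : Subset n} b → B ⊆ A → insertAt B e b ⊆ insertAt A e b
  insertAt-mono {A = A} b B⊆A {x} x∈ with insertView e x
  ... | at with e∈insertAt⁻ x∈
  ...   | refl = e∈insertAt A
  insertAt-mono b B⊆A x∈ | punched f = punchIn∈insertAt⁺ b (B⊆A (punchIn∈insertAt⁻ b x∈))

  insertAt-false⊆true : ∀ (A : Subset n) → insertAt A e false ⊆ insertAt A e true
  insertAt-false⊆true A {x} x∈ with insertView e x
  ... | at        = contradiction x∈ (e∉insertAt A)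
  ... | punched f = punchIn∈insertAt⁺ true (punchIn∈insertAt⁻ false x∈)

  insertAt-⊆⁻ : ∀ {B A : Subset n} {b b′} → insertAt B e b ⊆ insertAt A e b′ → B ⊆ A
  insertAt-⊆⁻ {b = b} {b′} sub f∈B = punchIn∈insertAt⁻ b′ (sub (punchIn∈insertAt⁺ b f∈B))

  ⊆insertAt-false⇒∉ : ∀ {B} {A : Subset n} → B ⊆ insertAt A e false → e ∉ B
  ⊆insertAt-false⇒∉ {A = A} sub e∈B = e∉insertAt A (sub e∈B)

  ⊆insertAt-true⇒⊆false : ∀ {B} {A : Subset n} → B ⊆ insertAt A e true → e ∉ B →
                          B ⊆ insertAt A e false
  ⊆insertAt-true⇒⊆false B⊆ e∉B {x} x∈B with insertView e x
  ... | at        = contradiction x∈B e∉B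
  ... | punched f = punchIn∈insertAt⁺ false (punchIn∈insertAt⁻ true (B⊆ x∈B))

  ∉⇒⊆insertAt⊤ : ∀ {B : Subset (suc n)} → e ∉ B → B ⊆ insertAt ⊤ e false
  ∉⇒⊆insertAt⊤ e∉B {x} x∈B with insertView e x
  ... | at        = contradiction x∈B e∉B
  ... | punched f = punchIn∈insertAt⁺ false ∈⊤

  insertAt-removeAt-∈ : ∀ {B : Subset (suc n)} → e ∈ B → insertAt (removeAt B e) e true ≡ B
  insertAt-removeAt-∈ {B} e∈B =
    subst (λ b → insertAt (removeAt B e) e b ≡ B) (∈⇒lookup e∈B) (insertAt-removeAt B e)

  insertAt-removeAt-∉ : ∀ {B : Subset (suc n)} → e ∉ B → insertAt (removeAt B e) e false ≡ B
  insertAt-removeAt-∉ {B} e∉B =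
    subst (λ b → insertAt (removeAt B e) e b ≡ B) (∉⇒lookup e∉B) (insertAt-removeAt B e)

∣insertAt-true∣ : ∀ (e : Fin (suc n)) (A : Subset n) → ∣ insertAt A e true ∣ ≡ suc ∣ A ∣
∣insertAt-true∣ zero    A           = refl
∣insertAt-true∣ (suc e) (true ∷ A)  = cong suc (∣insertAt-true∣ e A)
∣insertAt-true∣ (suc e) (false ∷ A) = ∣insertAt-true∣ e A

∣insertAt-false∣ : ∀ (e : Fin (suc n)) (A : Subset n) → ∣ insertAt A e false ∣ ≡ ∣ A ∣
∣insertAt-false∣ zero    A           = refl
∣insertAt-false∣ (suc e) (true ∷ A)  = cong suc (∣insertAt-false∣ e A)
∣insertAt-false∣ (suc e) (false ∷ A) = ∣insertAt-false∣ e A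

insertAt-⊤ : ∀ (e : Fin (suc n)) → insertAt ⊤ e true ≡ ⊤
insertAt-⊤         zero    = refl
insertAt-⊤ {suc n} (suc e) = cong (true ∷_) (insertAt-⊤ e)

-- Rank in independence systems

∈-subsets : (A : Subset n) → A ∈ˡ subsets n
∈-subsets []          = here refl
∈-subsets (true ∷ A)  = ∈-++⁺ˡ (∈-map⁺ (true ∷_) (∈-subsets A))
∈-subsets (false ∷ A) = ∈-++⁺ʳ (map (true ∷_) (subsets _)) (∈-map⁺ (false ∷_) (∈-subsets A))

⊆ᵇ⇒⊆ : (B A : Subset n) → T (B ⊆ᵇ A) → B ⊆ A
⊆ᵇ⇒⊆ (true ∷ B)  (true ∷ A) _ here         = here
⊆ᵇ⇒⊆ (_ ∷ B)     (_ ∷ A)    h (there x∈B) = there (⊆ᵇ⇒⊆ B A (proj₂ (T-∧ .to h)) x∈B)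

⊆⇒⊆ᵇ : (B A : Subset n) → B ⊆ A → T (B ⊆ᵇ A)
⊆⇒⊆ᵇ []          []      _   = _
⊆⇒⊆ᵇ (true ∷ B)  (a ∷ A) B⊆A with B⊆A here
... | here = ⊆⇒⊆ᵇ B A (drop-∷-⊆ B⊆A)
⊆⇒⊆ᵇ (false ∷ B) (a ∷ A) B⊆A = ⊆⇒⊆ᵇ B A (drop-∷-⊆ B⊆A)

module _ {A : Set} (f : A → ℕ) where

  maximum : List A → ℕ
  maximum = foldr (λ x r → f x ⊔ r) 0

  maximum-upper : ∀ {x xs} → x ∈ˡ xs → f x ≤ maximum xs
  maximum-upper {xs = y ∷ ys} (here refl) = ℕ.m≤m⊔n (f y) _
  maximum-upper {xs = y ∷ ys} (there x∈ys) = ℕ.m≤n⇒m≤o⊔n (f y) (maximum-upper x∈ys)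

  maximum-lub : ∀ {k} xs → (∀ {x} → x ∈ˡ xs → f x ≤ k) → maximum xs ≤ k
  maximum-lub []       _ = z≤n
  maximum-lub (y ∷ ys) h = ℕ.⊔-lub (h (here refl)) (maximum-lub ys (h ∘ there))

  maximum-attained : ∀ xs → maximum xs ≡ 0 ⊎ ∃ λ x → x ∈ˡ xs × f x ≡ maximum xs
  maximum-attained []       = inj₁ refl
  maximum-attained (y ∷ ys) with ℕ.⊔-sel (f y) (maximum ys)
  ... | inj₁ fy = inj₂ (y , here refl , sym fy)
  ... | inj₂ m  with maximum-attained ys
  ...   | inj₁ m≡0             = inj₁ (trans m m≡0)
  ...   | inj₂ (x , x∈ , fx≡m) = inj₂ (x , there x∈ , trans fx≡m (sym m))

module _ {n : ℕ} (indep : Subset n → Bool) where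

  private
    candidate : Subset n → Subset n → Bool
    candidate A B = indep B ∧ (B ⊆ᵇ A)

    candidate⁻ : ∀ {A B} → B ∈ˡ filterᵇ (candidate A) (subsets n) → Independent indep B × B ⊆ A
    candidate⁻ {A} {B} B∈ =
      let (indB , B⊆ᵇA) = T-∧ .to (proj₂ (∈-filter⁻ (T? ∘ candidate A) {xs = subsets n} B∈))
      in indB , ⊆ᵇ⇒⊆ B A B⊆ᵇA

  ∣B∣≤rank : ∀ {A B} → Independent indep B → B ⊆ A → ∣ B ∣ ≤ rank indep A
  ∣B∣≤rank {A} {B} indB B⊆A = maximum-upper ∣_∣
    (∈-filter⁺ (T? ∘ candidate A) (∈-subsets B) (T-∧ .from (indB , ⊆⇒⊆ᵇ B A B⊆A)))

  rank-lub : ∀ {A k} → (∀ {B} → Independent indep B → B ⊆ A → ∣ B ∣ ≤ k) → rank indep A ≤ k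
  rank-lub {A} h = maximum-lub ∣_∣ (filterᵇ (candidate A) (subsets n)) λ B∈ →
    let (indB , B⊆A) = candidate⁻ B∈ in h indB B⊆A

  rank-attained : Independent indep ⊥ → ∀ A →
                  ∃ λ B → Independent indep B × B ⊆ A × ∣ B ∣ ≡ rank indep A
  rank-attained ind⊥ A with maximum-attained ∣_∣ (filterᵇ (candidate A) (subsets n))
  ... | inj₁ rank≡0 = ⊥ , ind⊥ , ⊆-min A , trans (∣⊥∣≡0 n) (sym rank≡0)
  ... | inj₂ (B , B∈ , ∣B∣≡rank) = let (indB , B⊆A) = candidate⁻ B∈ in B , indB , B⊆A , ∣B∣≡rank

  rank-mono : ∀ {A A′} → A ⊆ A′ → rank indep A ≤ rank indep A′
  rank-mono A⊆A′ = rank-lub λ indB B⊆A → ∣B∣≤rank indB (A⊆A′ ∘ B⊆A)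

  rank≤∣A∣ : ∀ A → rank indep A ≤ ∣ A ∣
  rank≤∣A∣ A = rank-lub λ _ → p⊆q⇒∣p∣≤∣q∣

  DownClosed : Set
  DownClosed = ∀ {A B} → Independent indep A → B ⊆ A → Independent indep B

  extend-to-basis : DownClosed → ∀ {J} → Independent indep J → ∃ λ B → IsBasis indep B × J ⊆ B
  extend-to-basis down = extend (⊃-wellFounded _)
    where
    extend : ∀ {J} → Acc _⊃_ J → Independent indep J → ∃ λ B → IsBasis indep B × J ⊆ B
    extend {J} (acc larger) indJ with any? (λ x → ¬? (x ∈? J) ×-dec T? (indep (J ∪ ⁅ x ⁆)))
    ... | yes (x , x∉J , indJx) with extend (larger (p⊆p∪⁅y⁆ J , x , y∈p∪⁅y⁆ J , x∉J)) indJx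
    ...   | B , basis , J∪x⊆B = B , basis , J∪x⊆B ∘ p⊆p∪⁅y⁆ J
    extend {J} _ indJ | no stuck = J , (indJ , maximal) , id
      where
      maximal : (B : Subset n) → Independent indep B → J ⊆ B → B ≡ J
      maximal B indB J⊆B = ⊆-antisym B⊆J J⊆B
        where
        B⊆J : B ⊆ J
        B⊆J {x} x∈B with x ∈? J
        ... | yes x∈J = x∈J
        ... | no x∉J  = contradiction (x , x∉J , down indB (p∪⁅y⁆⊆q J⊆B x∈B)) stuck

module _ {n : ℕ} (indep : Subset (suc n) → Bool) (e : Fin (suc n)) where

  -- Both follow from augmentation in a matroid; they are all the rank identities below need of it.
  ExchangeIn : Set
  ExchangeIn = ∀ {J} → Independent indep J → e ∉ J →
               ∃ λ J′ → Independent indep J′ × e ∈ J′ × J′ ⊆ J ∪ ⁅ e ⁆ × ∣ J ∣ ≤ ∣ J′ ∣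

  ExchangeOut : Set
  ExchangeOut = ∀ {B J} → IsBasis indep B → e ∉ B → Independent indep J → e ∈ J →
                ∃ λ J′ → Independent indep J′ × e ∉ J′ × ∣ J ∣ ≤ ∣ J′ ∣

  module _ (indep′ : Subset n → Bool) where

    rank-insertAt-false : (∀ {B} → Independent indep (insertAt B e false) ⇔ Independent indep′ B) →
                          ∀ A → rank indep (insertAt A e false) ≡ rank indep′ A
    rank-insertAt-false ind⇔ A = ℕ.≤-antisym (rank-lub indep bound) (rank-lub indep′ lift)
      where
      bound : ∀ {B} → Independent indep B → B ⊆ insertAt A e false → ∣ B ∣ ≤ rank indep′ A
      bound {B} indB B⊆ with removeAt B e | insertAt-removeAt-∉ e (⊆insertAt-false⇒∉ e B⊆)
      ... | B′ | refl = subst (_≤ _) (sym (∣insertAt-false∣ e B′))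
                              (∣B∣≤rank indep′ (ind⇔ .to indB) (insertAt-⊆⁻ e B⊆))
      lift : ∀ {B} → Independent indep′ B → B ⊆ A → ∣ B ∣ ≤ rank indep (insertAt A e false)
      lift {B} indB B⊆A = subst (_≤ _) (∣insertAt-false∣ e B)
                                (∣B∣≤rank indep (ind⇔ .from indB) (insertAt-mono e false B⊆A))

    rank-insertAt-true : Independent indep′ ⊥ →
                         (∀ {B} → Independent indep (insertAt B e true) ⇔ Independent indep′ B) →
                         ExchangeIn → ∀ A → rank indep (insertAt A e true) ≡ suc (rank indep′ A)
    rank-insertAt-true ind⊥ ind⇔ exchange A = ℕ.≤-antisym (rank-lub indep bound) attained
      where
      bound-∈ : ∀ {B} → Independent indep B → B ⊆ insertAt A e true → e ∈ B →
                ∣ B ∣ ≤ suc (rank indep′ A)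
      bound-∈ {B} indB B⊆ e∈B with removeAt B e | insertAt-removeAt-∈ e e∈B
      ... | B′ | refl = subst (_≤ _) (sym (∣insertAt-true∣ e B′))
                              (s≤s (∣B∣≤rank indep′ (ind⇔ .to indB) (insertAt-⊆⁻ e B⊆)))
      bound : ∀ {B} → Independent indep B → B ⊆ insertAt A e true → ∣ B ∣ ≤ suc (rank indep′ A)
      bound {B} indB B⊆ with e ∈? B
      ... | yes e∈B = bound-∈ indB B⊆ e∈B
      ... | no e∉B  with exchange indB e∉B
      ...   | J′ , indJ′ , e∈J′ , J′⊆ , ∣B∣≤∣J′∣ =
              ℕ.≤-trans ∣B∣≤∣J′∣ (bound-∈ indJ′ (p∪⁅y⁆⊆q B⊆ (e∈insertAt e A) ∘ J′⊆) e∈J′)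
      attained : suc (rank indep′ A) ≤ rank indep (insertAt A e true)
      attained with rank-attained indep′ ind⊥ A
      ... | B , indB , B⊆A , ∣B∣≡rank = subst (_≤ _) (trans (∣insertAt-true∣ e B) (cong suc ∣B∣≡rank))
                                          (∣B∣≤rank indep (ind⇔ .from indB) (insertAt-mono e true B⊆A))

  rank-insertAt-loop : DownClosed indep → IsMatroidLoop indep e →
                       ∀ A → rank indep (insertAt A e true) ≡ rank indep (insertAt A e false)
  rank-insertAt-loop down loop A =
    ℕ.≤-antisym (rank-lub indep bound) (rank-mono indep (insertAt-false⊆true e A))
    where
    bound : ∀ {B} → Independent indep B → B ⊆ insertAt A e true → ∣ B ∣ ≤ rank indep (insertAt A e false)
    bound indB B⊆ =
      ∣B∣≤rank indep indB (⊆insertAt-true⇒⊆false e B⊆ λ e∈B → loop (down indB (⁅y⁆⊆q e∈B)))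

  rank-insertAt-coloop : DownClosed indep → Independent indep ⊥ → IsMatroidColoop indep e →
                         ∀ A → rank indep (insertAt A e true) ≡ suc (rank indep (insertAt A e false))
  rank-insertAt-coloop down ind⊥ coloop A = ℕ.≤-antisym (rank-lub indep bound) attained
    where
    bound : ∀ {B} → Independent indep B → B ⊆ insertAt A e true →
            ∣ B ∣ ≤ suc (rank indep (insertAt A e false))
    bound {B} indB B⊆ with e ∈? B
    ... | no e∉B  = ℕ.m≤n⇒m≤1+n (∣B∣≤rank indep indB (⊆insertAt-true⇒⊆false e B⊆ e∉B))
    ... | yes e∈B = subst (_≤ _) (1+∣p─⁅y⁆∣≡∣p∣ B e∈B)
                          (s≤s (∣B∣≤rank indep (down indB B-e⊆B) B-e⊆))
      where
      B-e⊆B : B ─ ⁅ e ⁆ ⊆ B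
      B-e⊆B x∈ = proj₂ (x∈p─⁅y⁆⁻ B x∈)
      B-e⊆ : B ─ ⁅ e ⁆ ⊆ insertAt A e false
      B-e⊆ = ⊆insertAt-true⇒⊆false e (B⊆ ∘ B-e⊆B) (λ e∈ → proj₁ (x∈p─⁅y⁆⁻ B e∈) refl)
    attained : suc (rank indep (insertAt A e false)) ≤ rank indep (insertAt A e true)
    attained with rank-attained indep ind⊥ (insertAt A e false)
    ... | J , indJ , J⊆ , ∣J∣≡rank with T? (indep (J ∪ ⁅ e ⁆))
    ...   | yes indJe =
            subst (_≤ _) (trans (∣p∪⁅y⁆∣≡1+∣p∣ J (⊆insertAt-false⇒∉ e J⊆)) (cong suc ∣J∣≡rank))
                  (∣B∣≤rank indep indJe (p∪⁅y⁆⊆q (insertAt-false⊆true e A ∘ J⊆) (e∈insertAt e A)))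
    ...   | no ¬indJe with extend-to-basis indep down indJ
    ...     | B , basis , J⊆B =
              contradiction (down (proj₁ basis) (p∪⁅y⁆⊆q J⊆B (coloop B basis))) ¬indJe

  -- ¬ IsMatroidColoop yields no basis avoiding e, so the ranks are compared decidably and a
  -- failure of the inequality is turned into a proof that e is a coloop.
  rank-⊤-noncoloop : Independent indep ⊥ → ExchangeOut → ¬ IsMatroidColoop indep e →
                     rank indep ⊤ ≡ rank indep (insertAt ⊤ e false)
  rank-⊤-noncoloop ind⊥ exchange ¬coloop with rank indep ⊤ ℕ.≤? rank indep (insertAt ⊤ e false)
  ... | yes r⊤≤ = ℕ.≤-antisym r⊤≤ (rank-mono indep ⊆⊤)
  ... | no r⊤≰ = contradiction coloop ¬coloop
    where
    avoiding : ∀ {J} → Independent indep J → e ∉ J → ∣ J ∣ ≤ rank indep (insertAt ⊤ e false)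
    avoiding indJ e∉J = ∣B∣≤rank indep indJ (∉⇒⊆insertAt⊤ e e∉J)
    coloop : IsMatroidColoop indep e
    coloop B basis with e ∈? B
    ... | yes e∈B = e∈B
    ... | no e∉B with rank-attained indep ind⊥ ⊤
    ...   | J , indJ , _ , ∣J∣≡rank with e ∈? J
    ...     | no e∉J  = contradiction (subst (_≤ _) ∣J∣≡rank (avoiding indJ e∉J)) r⊤≰
    ...     | yes e∈J with exchange basis e∉B indJ e∈J
    ...       | J′ , indJ′ , e∉J′ , ∣J∣≤∣J′∣ =
                contradiction (subst (_≤ _) ∣J∣≡rank (ℕ.≤-trans ∣J∣≤∣J′∣ (avoiding indJ′ e∉J′))) r⊤≰

-- Walks and multipaths

module _ {V E : ℕ} (G : Digraph V E) where

  -- The _+_ and _*_ of ℕ are opened only locally: at top level these names belong to ℤ.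
  open import Data.Nat using (_+_; _*_)

  Edge : Subset E → Fin V → Fin V → Set
  Edge K a b = ∃ λ f → f ∈ K × src G f ≡ a × tgt G f ≡ b

  SrcInjective TgtInjective : Subset E → Set
  SrcInjective K = ∀ {f g} → f ∈ K → g ∈ K → src G f ≡ src G g → f ≡ g
  TgtInjective K = ∀ {f g} → f ∈ K → g ∈ K → tgt G f ≡ tgt G g → f ≡ g

  Acyclic : Subset E → Set
  Acyclic K = ∀ c n → walk G K (suc n) (just c) ≢ just c

  record Multipath (K : Subset E) : Set where
    field
      loopless      : ∀ {f} → f ∈ K → src G f ≢ tgt G f
      src-injective : SrcInjective K
      tgt-injective : TgtInjective K
      acyclic       : Acyclic K

  open Multipath public

  private
    -- nextB G K a is scan K a (allFin E).
    scan : Subset E → Fin V → List (Fin E) → Maybe (Fin V)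
    scan K a = foldr (λ f r → if lookup K f ∧ (_==_ G (src G f) a) then just (tgt G f) else r) nothing

    scan-just : ∀ {K a b} xs → scan K a xs ≡ just b → Edge K a b
    scan-just {K} {a} (f ∷ fs) eq with lookup K f in f∈K | src G f ≟ a
    ... | true  | yes refl = f , lookup⇒∈ f∈K , refl , just-injective eq
    ... | true  | no _     = scan-just fs eq
    ... | false | _        = scan-just fs eq

    scan-nothing : ∀ {K a f} xs → scan K a xs ≡ nothing → f ∈ˡ xs → f ∈ K → src G f ≢ a
    scan-nothing {K} {a} (g ∷ gs) eq f∈ f∈K with lookup K g in g∈K | src G g ≟ a
    scan-nothing (g ∷ gs) () f∈ f∈K | true | yes _
    scan-nothing (g ∷ gs) eq (here refl) f∈K | true  | no g≢a = g≢a
    scan-nothing (g ∷ gs) eq (here refl) f∈K | false | _      =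
      contradiction (trans (sym (∈⇒lookup f∈K)) g∈K) λ ()
    scan-nothing (g ∷ gs) eq (there f∈) f∈K  | true  | no _   = scan-nothing gs eq f∈ f∈K
    scan-nothing (g ∷ gs) eq (there f∈) f∈K  | false | _      = scan-nothing gs eq f∈ f∈K

  nextB-just : ∀ {K a b} → nextB G K a ≡ just b → Edge K a b
  nextB-just = scan-just (allFin E)

  nextB-nothing : ∀ {K a f} → nextB G K a ≡ nothing → f ∈ K → src G f ≢ a
  nextB-nothing {f = f} eq = scan-nothing (allFin E) eq (∈-allFin f)

  nextB-edge : ∀ {K a b} → SrcInjective K → Edge K a b → nextB G K a ≡ just b
  nextB-edge {K} {a} inj (f , f∈K , refl , refl) with nextB G K (src G f) in eq
  ... | nothing = contradiction refl (nextB-nothing eq f∈K)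
  ... | just b with nextB-just eq
  ...   | g , g∈K , sg , refl with inj f∈K g∈K (sym sg)
  ...     | refl = refl

  walk-nothing : ∀ K n → walk G K n nothing ≡ nothing
  walk-nothing K zero    = refl
  walk-nothing K (suc n) = refl

  walk-+ : ∀ K m n x → walk G K (m + n) x ≡ walk G K n (walk G K m x)
  walk-+ K zero    n x        = refl
  walk-+ K (suc m) n nothing  = sym (walk-nothing K n)
  walk-+ K (suc m) n (just a) = walk-+ K m n (nextB G K a)

  walk-first-edge : ∀ {K} m {a b} → walk G K (suc m) (just a) ≡ just b → ∃ λ f → f ∈ K × src G f ≡ a
  walk-first-edge {K} m {a} reach with nextB G K a in step
  ... | nothing = contradiction (trans (sym (walk-nothing K m)) reach) λ ()
  ... | just _  with nextB-just step
  ...   | f , f∈K , src-f , _ = f , f∈K , src-f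

  walk-step : ∀ K n a → walk G K (suc n) (just a) ≡ walk G K 1 (walk G K n (just a))
  walk-step K n a = trans (cong (λ m → walk G K m (just a)) (ℕ.+-comm 1 n)) (walk-+ K n 1 (just a))

  walk-prefix : ∀ K {m n} x {b} → m ≤ n → walk G K n x ≡ just b → ∃ λ c → walk G K m x ≡ just c
  walk-prefix K {m} x m≤n eq with ℕ.m≤n⇒∃[o]m+o≡n m≤n
  ... | o , refl with walk G K m x in prefix
  ...   | just c  = c , refl
  ...   | nothing = contradiction (trans (sym stops) eq) λ ()
    where
    stops : walk G K (m + o) x ≡ nothing
    stops = trans (walk-+ K m o x) (trans (cong (walk G K o) prefix) (walk-nothing K o))

  walk-iterate : ∀ K c n k → walk G K (suc n) (just c) ≡ just c → walk G K (k * suc n) (just c) ≡ just c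
  walk-iterate K c n zero    closed = refl
  walk-iterate K c n (suc k) closed = begin
    walk G K (suc n + k * suc n) (just c)           ≡⟨ walk-+ K (suc n) (k * suc n) (just c) ⟩
    walk G K (k * suc n) (walk G K (suc n) (just c)) ≡⟨ cong (walk G K (k * suc n)) closed ⟩
    walk G K (k * suc n) (just c)                   ≡⟨ walk-iterate K c n k closed ⟩
    just c                                          ∎
    where open ≡-Reasoning

  position : Subset E → Fin V → ℕ → Fin V
  position K c i = fromMaybe c (walk G K i (just c))

  walk-position : ∀ K {c i n u} → i ≤ n → walk G K n (just c) ≡ just u →
                  walk G K i (just c) ≡ just (position K c i)
  walk-position K {c} i≤n long with walk-prefix K (just c) i≤n long
  ... | _ , reach rewrite reach = refl

  long-walk⇒closed-walk : ∀ K c {u} → walk G K V (just c) ≡ just u →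
                          ∃₂ λ d n → walk G K (suc n) (just d) ≡ just d
  long-walk⇒closed-walk K c long with pigeonhole (ℕ.n<1+n V) (position K c ∘ toℕ)
  ... | i , j , i<j , same with ℕ.m≤n⇒∃[o]m+o≡n i<j
  ...   | k , i+1+k≡j = position K c (toℕ i) , k , (begin
    walk G K (suc k) (just (position K c (toℕ i)))    ≡⟨ cong (walk G K (suc k)) (reaches i) ⟨
    walk G K (suc k) (walk G K (toℕ i) (just c))      ≡⟨ walk-+ K (toℕ i) (suc k) (just c) ⟨
    walk G K (toℕ i + suc k) (just c)                 ≡⟨ cong (λ m → walk G K m (just c)) i+1+k≡j′ ⟩
    walk G K (toℕ j) (just c)                         ≡⟨ reaches j ⟩
    just (position K c (toℕ j))                       ≡⟨ cong just same ⟨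
    just (position K c (toℕ i))                       ∎)
    where
    open ≡-Reasoning
    i+1+k≡j′ : toℕ i + suc k ≡ toℕ j
    i+1+k≡j′ = trans (ℕ.+-suc (toℕ i) k) i+1+k≡j
    reaches : ∀ (i : Fin (suc V)) → walk G K (toℕ i) (just c) ≡ just (position K c (toℕ i))
    reaches i = walk-position K (ℕ.≤-pred (toℕ<n i)) long

  Acyclic⇒walks-stop : ∀ {K} → Acyclic K → ∀ c → walk G K V (just c) ≡ nothing
  Acyclic⇒walks-stop {K} acyclic c with walk G K V (just c) in long
  ... | nothing = refl
  ... | just _  with long-walk⇒closed-walk K c long
  ...   | d , n , closed = contradiction closed (acyclic d n)

  walks-stop⇒Acyclic : ∀ {K} → (∀ c → walk G K V (just c) ≡ nothing) → Acyclic K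
  walks-stop⇒Acyclic {K} stops c n closed
    with walk-prefix K (just c) (ℕ.m≤m*n V (suc n)) (walk-iterate K c n V closed)
  ... | _ , long = contradiction (trans (sym (stops c)) long) λ ()

  acyclic-or-cycle : ∀ K → Acyclic K ⊎ ∃₂ λ c n → walk G K (suc n) (just c) ≡ just c
  acyclic-or-cycle K with all? (λ c → Maybe.≡-dec _≟_ (walk G K V (just c)) nothing)
  ... | yes stops = inj₁ (walks-stop⇒Acyclic stops)
  ... | no ¬stops with ¬∀⟶∃¬ V _ (λ c → Maybe.≡-dec _≟_ (walk G K V (just c)) nothing) ¬stops
  ...   | c , long with walk G K V (just c) in eq
  ...     | nothing = contradiction refl long
  ...     | just _  = inj₂ (long-walk⇒closed-walk K c eq)

  -- The first two conjuncts of isMultipath use a disjunction local to Defs that cannot be named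
  -- here; the arguments allᵇ _ (allFin _) let unification recover the conjuncts from their shape.
  -- The pointwise tests okf and okfg are kept in scope only so that the cases where they reduce
  -- to ⊥ are discharged by the coverage checker.
  isMultipath⇒Multipath : ∀ {K} → T (isMultipath G K) → Multipath K
  isMultipath⇒Multipath {K} ok
    with loopless-ok , ends-ok , stops-ok ←
           ∧³≡true {allᵇ _ (allFin E)} {allᵇ _ (allFin E)} {allᵇ _ (allFin V)} (T-≡ .to ok)
    = record
    { loopless      = no-loop
    ; src-injective = λ f∈K g∈K → proj₁ (ends-distinct f∈K g∈K)
    ; tgt-injective = λ f∈K g∈K → proj₂ (ends-distinct f∈K g∈K)
    ; acyclic       = walks-stop⇒Acyclic λ c → is-nothing⇒≡nothing (allᵇ⁻ stops-ok (∈-allFin c))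
    }
    where
    no-loop : ∀ {f} → f ∈ K → src G f ≢ tgt G f
    no-loop {f} f∈K with allᵇ⁻ loopless-ok (∈-allFin f)
    ... | okf with lookup K f | ∈⇒lookup f∈K | src G f ≟ tgt G f
    ...   | _ | refl | no src≢tgt = src≢tgt

    ends-distinct : ∀ {f g} → f ∈ K → g ∈ K →
                    (src G f ≡ src G g → f ≡ g) × (tgt G f ≡ tgt G g → f ≡ g)
    ends-distinct {f} {g} f∈K g∈K with allᵇ⁻ (allᵇ⁻ ends-ok (∈-allFin f)) (∈-allFin g)
    ... | okfg with lookup K f | ∈⇒lookup f∈K | lookup K g | ∈⇒lookup g∈K
                  | f ≟ g | src G f ≟ src G g | tgt G f ≟ tgt G g
    ...   | _ | refl | _ | refl | yes f≡g | _        | _        = (λ _ → f≡g) , (λ _ → f≡g)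
    ...   | _ | refl | _ | refl | no _    | no src≢ | no tgt≢ = (⊥-elim ∘ src≢) , (⊥-elim ∘ tgt≢)

  Multipath⇒isMultipath : ∀ {K} → Multipath K → T (isMultipath G K)
  Multipath⇒isMultipath {K} mp with isMultipath G K in ok
  ... | true  = _
  ... | false with ∧³≡false {allᵇ _ (allFin E)} {allᵇ _ (allFin E)} {allᵇ _ (allFin V)} ok
  ...   | inj₁ loopless-fails with allᵇ≡false (allFin E) loopless-fails
  ...     | f , _ , fails with lookup K f in f∈K | src G f ≟ tgt G f
  ...       | true  | yes loop = loopless mp (lookup⇒∈ f∈K) loop
  Multipath⇒isMultipath {K} mp | false | inj₂ (inj₁ ends-fail) with allᵇ≡false (allFin E) ends-fail
  ... | f , _ , f-fails with allᵇ≡false (allFin E) f-fails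
  ...   | g , _ , fails with lookup K f in f∈K | lookup K g in g∈K
                          | f ≟ g | src G f ≟ src G g | tgt G f ≟ tgt G g
  ...     | true | true | no f≢g | yes src≡ | _        =
            f≢g (src-injective mp (lookup⇒∈ f∈K) (lookup⇒∈ g∈K) src≡)
  ...     | true | true | no f≢g | no _     | yes tgt≡ =
            f≢g (tgt-injective mp (lookup⇒∈ f∈K) (lookup⇒∈ g∈K) tgt≡)
  Multipath⇒isMultipath {K} mp | false | inj₂ (inj₂ stops-fail) with allᵇ≡false (allFin V) stops-fail
  ... | c , _ , fails with walk G K V (just c) | Acyclic⇒walks-stop (acyclic mp) c
  ...   | _ | refl with fails
  ...     | ()

  Multipath-⊥ : Multipath ⊥
  Multipath-⊥ = record
    { loopless      = λ f∈⊥ → contradiction f∈⊥ ∉⊥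
    ; src-injective = λ f∈⊥ → contradiction f∈⊥ ∉⊥
    ; tgt-injective = λ f∈⊥ → contradiction f∈⊥ ∉⊥
    ; acyclic       = λ c n closed → contradiction (trans (sym (stuck c n)) closed) λ ()
    }
    where
    stuck : ∀ c n → walk G ⊥ (suc n) (just c) ≡ nothing
    stuck c n with nextB G ⊥ c in eq
    ... | nothing = walk-nothing ⊥ n
    ... | just _  = contradiction (proj₁ (proj₂ (nextB-just eq))) ∉⊥

  walk-mono : ∀ {K K′} → SrcInjective K′ → K ⊆ K′ → ∀ m x {b} →
              walk G K m x ≡ just b → walk G K′ m x ≡ just b
  walk-mono inj K⊆K′ zero    x        eq = eq
  walk-mono {K} {K′} inj K⊆K′ (suc m) (just a) eq with nextB G K a in step
  ... | nothing = contradiction (trans (sym (walk-nothing K m)) eq) λ ()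
  ... | just c with nextB-just step
  ...   | f , f∈K , sf , tf = trans (cong (walk G K′ m) (nextB-edge inj (f , K⊆K′ f∈K , sf , tf)))
                                    (walk-mono inj K⊆K′ m (just c) eq)

  Multipath-⊆ : ∀ {K K′} → Multipath K′ → K ⊆ K′ → Multipath K
  Multipath-⊆ mp K⊆K′ = record
    { loopless      = loopless mp ∘ K⊆K′
    ; src-injective = λ f∈K g∈K → src-injective mp (K⊆K′ f∈K) (K⊆K′ g∈K)
    ; tgt-injective = λ f∈K g∈K → tgt-injective mp (K⊆K′ f∈K) (K⊆K′ g∈K)
    ; acyclic       = λ c n → acyclic mp c n ∘ walk-mono (src-injective mp) K⊆K′ (suc n) (just c)
    }

module _ {V E₁ E₂ : ℕ} (G₁ : Digraph V E₁) (G₂ : Digraph V E₂)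
         {K₁ : Subset E₁} {K₂ : Subset E₂} where

  nextB-cong : ∀ {a} → SrcInjective G₂ K₂ →
               (∀ {b} → Edge G₁ K₁ a b → Edge G₂ K₂ a b) →
               (∀ {b} → Edge G₂ K₂ a b → Edge G₁ K₁ a b) →
               nextB G₁ K₁ a ≡ nextB G₂ K₂ a
  nextB-cong {a} inj forth back with nextB G₁ K₁ a in eq₁
  ... | just b  = sym (nextB-edge G₂ inj (forth (nextB-just G₁ eq₁)))
  ... | nothing with nextB G₂ K₂ a in eq₂
  ...   | nothing = refl
  ...   | just b with back (nextB-just G₂ eq₂)
  ...     | f , f∈K₁ , sf , _ = contradiction sf (nextB-nothing G₁ eq₁ f∈K₁)

  walk-cong : (∀ a → nextB G₁ K₁ a ≡ nextB G₂ K₂ a) →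
              ∀ n x → walk G₁ K₁ n x ≡ walk G₂ K₂ n x
  walk-cong same zero    x        = refl
  walk-cong same (suc n) nothing  = refl
  walk-cong same (suc n) (just a) = trans (cong (walk G₁ K₁ n) (same a)) (walk-cong same n (nextB G₂ K₂ a))

-- Deletion

module _ {V E : ℕ} (G : Digraph V (suc E)) (e : Fin (suc E)) {B : Subset E} where

  private
    D : Digraph V E
    D = delete G e

    B⁻ : Subset (suc E)
    B⁻ = insertAt B e false

    edge-to : ∀ {a b} → Edge D B a b → Edge G B⁻ a b
    edge-to (f , f∈B , s , t) = punchIn e f , punchIn∈insertAt⁺ e false f∈B , s , t

    edge-from : ∀ {a b} → Edge G B⁻ a b → Edge D B a b
    edge-from (g , g∈ , s , t) with ∈insertAt-false⁻ e g∈
    ... | f , refl , f∈B = f , f∈B , s , t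

    walks-agree : SrcInjective G B⁻ → ∀ n c → walk D B n (just c) ≡ walk G B⁻ n (just c)
    walks-agree inj n c = walk-cong D G (λ _ → nextB-cong D G inj edge-to edge-from) n (just c)

  deletion⇒insertion : Multipath D B → Multipath G B⁻
  deletion⇒insertion mp = record
    { loopless      = no-loop
    ; src-injective = src-inj
    ; tgt-injective = tgt-inj
    ; acyclic       = λ c n closed → acyclic mp c n (trans (walks-agree src-inj (suc n) c) closed)
    }
    where
    no-loop : ∀ {g} → g ∈ B⁻ → src G g ≢ tgt G g
    no-loop g∈ with ∈insertAt-false⁻ e g∈
    ... | f , refl , f∈B = loopless mp f∈B
    src-inj : SrcInjective G B⁻
    src-inj g∈ h∈ eq with ∈insertAt-false⁻ e g∈ | ∈insertAt-false⁻ e h∈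
    ... | f , refl , f∈B | f′ , refl , f′∈B = cong (punchIn e) (src-injective mp f∈B f′∈B eq)
    tgt-inj : TgtInjective G B⁻
    tgt-inj g∈ h∈ eq with ∈insertAt-false⁻ e g∈ | ∈insertAt-false⁻ e h∈
    ... | f , refl , f∈B | f′ , refl , f′∈B = cong (punchIn e) (tgt-injective mp f∈B f′∈B eq)

  insertion⇒deletion : Multipath G B⁻ → Multipath D B
  insertion⇒deletion mp = record
    { loopless      = loopless mp ∘ lift
    ; src-injective = λ f∈B f′∈B → punchIn-injective e _ _ ∘ src-injective mp (lift f∈B) (lift f′∈B)
    ; tgt-injective = λ f∈B f′∈B → punchIn-injective e _ _ ∘ tgt-injective mp (lift f∈B) (lift f′∈B)
    ; acyclic       = λ c n closed → acyclic mp c n (trans (sym (walks-agree (src-injective mp) (suc n) c)) closed)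
    }
    where
    lift : ∀ {f} → f ∈ B → punchIn e f ∈ B⁻
    lift = punchIn∈insertAt⁺ e false

  Multipath-delete : Multipath D B ⇔ Multipath G B⁻
  Multipath-delete = mk⇔ deletion⇒insertion insertion⇒deletion

-- Contraction

module _ {V E : ℕ} (G : Digraph (suc V) (suc E)) (e : Fin (suc E)) (nl : src G e ≢ tgt G e) where

  open import Data.Nat using (_+_; _*_)

  private
    v w : Fin (suc V)
    v = src G e
    w = tgt G e

    merge : Fin (suc V) → Fin V
    merge = mergeVertex G e nl

    w≢v : w ≢ v
    w≢v = nl ∘ sym

  punchIn-mergeVertex : ∀ {u} → w ≢ u → punchIn w (merge u) ≡ u
  punchIn-mergeVertex {u} w≢u with w ≟ u
  ... | yes w≡u = contradiction w≡u w≢u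
  ... | no w≢u′ = punchIn-punchOut w≢u′

  mergeVertex-tgt : merge w ≡ merge v
  mergeVertex-tgt with w ≟ w | w ≟ v
  ... | no w≢w  | _       = contradiction refl w≢w
  ... | yes _   | yes w≡v = contradiction w≡v w≢v
  ... | yes _   | no _    = punchOut-cong w refl

  mergeVertex-punchIn : ∀ c → merge (punchIn w c) ≡ c
  mergeVertex-punchIn c with w ≟ punchIn w c
  ... | yes w≡ = contradiction (sym w≡) (punchInᵢ≢i w c)
  ... | no _   = trans (punchOut-cong w refl) (punchOut-punchIn w)

  mergeVertex≡x⇒≡v : ∀ {u} → merge u ≡ merge v → u ≢ w → u ≡ v
  mergeVertex≡x⇒≡v {u} eq u≢w = trans (sym (punchIn-mergeVertex (u≢w ∘ sym)))
                                      (trans (cong (punchIn w) eq) (punchIn-mergeVertex w≢v))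

  mergeVertex-cases : ∀ {a b} → merge a ≡ merge b → a ≡ b ⊎ (a ≡ v × b ≡ w) ⊎ (a ≡ w × b ≡ v)
  mergeVertex-cases {a} {b} eq with a ≟ w | b ≟ w
  ... | yes refl | yes refl = inj₁ refl
  ... | yes refl | no b≢w   = inj₂ (inj₂ (refl , mergeVertex≡x⇒≡v (trans (sym eq) mergeVertex-tgt) b≢w))
  ... | no a≢w   | yes refl = inj₂ (inj₁ (mergeVertex≡x⇒≡v (trans eq mergeVertex-tgt) a≢w , refl))
  ... | no a≢w   | no b≢w   = inj₁ (trans (sym (punchIn-mergeVertex (a≢w ∘ sym)))
                                      (trans (cong (punchIn w) eq) (punchIn-mergeVertex (b≢w ∘ sym))))
  mergeVertex-injective-off-v : ∀ {a b} → a ≢ v → b ≢ v → merge a ≡ merge b → a ≡ b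
  mergeVertex-injective-off-v a≢v b≢v eq with mergeVertex-cases eq
  ... | inj₁ a≡b             = a≡b
  ... | inj₂ (inj₁ (a≡v , _)) = contradiction a≡v a≢v
  ... | inj₂ (inj₂ (_ , b≡v)) = contradiction b≡v b≢v

  mergeVertex-onto-off-v : ∀ c → ∃ λ a → a ≢ v × merge a ≡ c
  mergeVertex-onto-off-v c with punchIn w c ≟ v
  ... | no  c′≢v = punchIn w c , c′≢v , mergeVertex-punchIn c
  ... | yes c′≡v = w , w≢v , trans mergeVertex-tgt (trans (cong merge (sym c′≡v)) (mergeVertex-punchIn c))

  private
    C : Digraph V E
    C = contract G e nl

  module _ (f : Fin E) where

    contract-ends : src G (punchIn e f) ≢ v → tgt G (punchIn e f) ≢ w →
                    src C f ≡ merge (src G (punchIn e f)) × tgt C f ≡ merge (tgt G (punchIn e f))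
    contract-ends s≢v t≢w with src G (punchIn e f) ≟ v | tgt G (punchIn e f) ≟ w
    ... | yes s≡v | _       = contradiction s≡v s≢v
    ... | no _    | yes t≡w = contradiction t≡w t≢w
    ... | no _    | no _    = refl , refl

    contract-collapses : src G (punchIn e f) ≡ v ⊎ tgt G (punchIn e f) ≡ w → src C f ≡ tgt C f
    contract-collapses touches with src G (punchIn e f) ≟ v | tgt G (punchIn e f) ≟ w
    ... | yes _   | _       = refl
    ... | no _    | yes _   = refl
    ... | no s≢v  | no t≢w  with touches
    ...   | inj₁ s≡v = contradiction s≡v s≢v
    ...   | inj₂ t≡w = contradiction t≡w t≢w

  module _ {B : Subset E} where

    private
      B⁺ : Subset (suc E)
      B⁺ = insertAt B e true

      e∈B⁺ : e ∈ B⁺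
      e∈B⁺ = e∈insertAt e B

      punchIn∈B⁺ : ∀ {f} → f ∈ B → punchIn e f ∈ B⁺
      punchIn∈B⁺ = punchIn∈insertAt⁺ e true

      module FromContraction (mp : Multipath C B) where

        src≢v : ∀ {f} → f ∈ B → src G (punchIn e f) ≢ v
        src≢v {f} f∈B = loopless mp f∈B ∘ contract-collapses f ∘ inj₁

        tgt≢w : ∀ {f} → f ∈ B → tgt G (punchIn e f) ≢ w
        tgt≢w {f} f∈B = loopless mp f∈B ∘ contract-collapses f ∘ inj₂

        ends : ∀ {f} → f ∈ B →
               src C f ≡ merge (src G (punchIn e f)) × tgt C f ≡ merge (tgt G (punchIn e f))
        ends {f} f∈B = contract-ends f (src≢v f∈B) (tgt≢w f∈B)

        no-loop : ∀ {g} → g ∈ B⁺ → src G g ≢ tgt G g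
        no-loop g∈ with ∈insertAt-true⁻ e g∈
        ... | inj₁ refl             = nl
        ... | inj₂ (f , refl , f∈B) = λ s≡t →
              loopless mp f∈B (trans (proj₁ (ends f∈B)) (trans (cong merge s≡t) (sym (proj₂ (ends f∈B)))))

        end-injective : (end : ∀ {V E} → Digraph V E → Fin E → Fin V) →
                        (∀ {f} → f ∈ B → end G (punchIn e f) ≢ end G e) →
                        (∀ {f} → f ∈ B → end C f ≡ merge (end G (punchIn e f))) →
                        (∀ {f f′} → f ∈ B → f′ ∈ B → end C f ≡ end C f′ → f ≡ f′) →
                        ∀ {g h} → g ∈ B⁺ → h ∈ B⁺ → end G g ≡ end G h → g ≡ h
        end-injective end avoids merged inj g∈ h∈ eq with ∈insertAt-true⁻ e g∈ | ∈insertAt-true⁻ e h∈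
        ... | inj₁ refl             | inj₁ refl               = refl
        ... | inj₁ refl             | inj₂ (f , refl , f∈B)   = contradiction (sym eq) (avoids f∈B)
        ... | inj₂ (f , refl , f∈B) | inj₁ refl               = contradiction eq (avoids f∈B)
        ... | inj₂ (f , refl , f∈B) | inj₂ (f′ , refl , f′∈B) =
              cong (punchIn e) (inj f∈B f′∈B (trans (merged f∈B) (trans (cong merge eq) (sym (merged f′∈B)))))

        -- Steps along e vanish in C, but e (not a loop) is never taken twice in a row, so
        -- n ≤ 2k + 1, and n ≤ 2k unless the walk starts at v.
        project-walk : ∀ n {a b} → walk G B⁺ n (just a) ≡ just b →
                       ∃ λ k → walk C B k (just (merge a)) ≡ just (merge b) ×
                               n ≤ suc (k + k) × (a ≢ v → n ≤ k + k)
        project-walk zero    refl = 0 , refl , z≤n , λ _ → z≤n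
        project-walk (suc n) {a} walk≡ with nextB G B⁺ a in step
        ... | nothing = contradiction (trans (sym (walk-nothing G B⁺ n)) walk≡) λ ()
        ... | just t with nextB-just G step
        ...   | g , g∈ , refl , refl with ∈insertAt-true⁻ e g∈ | project-walk n walk≡
        ...     | inj₁ refl | k , walkᶜ , _ , n≤2k =
                  k , trans (cong (λ z → walk C B k (just z)) (sym mergeVertex-tgt)) walkᶜ , s≤s (n≤2k w≢v)
                    , λ v≢v → contradiction refl v≢v
        ...     | inj₂ (f , refl , f∈B) | k , walkᶜ , n≤2k+1 , _ =
                  suc k , trans (cong (walk C B k) stepᶜ) walkᶜ , ℕ.m≤n⇒m≤1+n bound , λ _ → bound
          where
          stepᶜ : nextB C B (merge (src G (punchIn e f))) ≡ just (merge (tgt G (punchIn e f)))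
          stepᶜ = nextB-edge C (src-injective mp) (f , f∈B , proj₁ (ends f∈B) , proj₂ (ends f∈B))
          bound : suc n ≤ suc k + suc k
          bound = subst (suc n ≤_) (cong suc (sym (ℕ.+-suc k k))) (s≤s n≤2k+1)

        no-cycle : Acyclic G B⁺
        no-cycle c n closed with project-walk (suc n) closed
        ... | suc k , walkᶜ , _ , _ = acyclic mp (merge c) k walkᶜ
        ... | zero  , _ , s≤s n≤0 , _ with n | n≤0
        ...   | zero | z≤n with nextB-just G closed
        ...     | g , g∈ , sg , tg = no-loop g∈ (trans sg (sym tg))

      module FromInsertion (mp : Multipath G B⁺) where

        src≢v : ∀ {f} → f ∈ B → src G (punchIn e f) ≢ v
        src≢v {f} f∈B = punchInᵢ≢i e f ∘ src-injective mp (punchIn∈B⁺ f∈B) e∈B⁺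

        tgt≢w : ∀ {f} → f ∈ B → tgt G (punchIn e f) ≢ w
        tgt≢w {f} f∈B = punchInᵢ≢i e f ∘ tgt-injective mp (punchIn∈B⁺ f∈B) e∈B⁺

        ends : ∀ {f} → f ∈ B →
               src C f ≡ merge (src G (punchIn e f)) × tgt C f ≡ merge (tgt G (punchIn e f))
        ends {f} f∈B = contract-ends f (src≢v f∈B) (tgt≢w f∈B)

        e-step : nextB G B⁺ v ≡ just w
        e-step = nextB-edge G (src-injective mp) (e , e∈B⁺ , refl , refl)

        no-loop : ∀ {f} → f ∈ B → src C f ≢ tgt C f
        no-loop {f} f∈B eq
          with mergeVertex-cases (trans (sym (proj₁ (ends f∈B))) (trans eq (proj₂ (ends f∈B))))
        ... | inj₁ s≡t                = loopless mp (punchIn∈B⁺ f∈B) s≡t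
        ... | inj₂ (inj₁ (s≡v , _))   = src≢v f∈B s≡v
        ... | inj₂ (inj₂ (s≡w , t≡v)) = acyclic mp v 1 (begin
          walk G B⁺ 2 (just v)   ≡⟨ cong (walk G B⁺ 1) e-step ⟩
          walk G B⁺ 1 (just w)   ≡⟨ nextB-edge G (src-injective mp) (_ , punchIn∈B⁺ f∈B , s≡w , t≡v) ⟩
          just v                 ∎)
          where open ≡-Reasoning

        src-inj : SrcInjective C B
        src-inj {f} {f′} f∈B f′∈B eq
          with mergeVertex-cases (trans (sym (proj₁ (ends f∈B))) (trans eq (proj₁ (ends f′∈B))))
        ... | inj₁ s≡s′              =
              punchIn-injective e f f′ (src-injective mp (punchIn∈B⁺ f∈B) (punchIn∈B⁺ f′∈B) s≡s′)
        ... | inj₂ (inj₁ (s≡v , _))  = contradiction s≡v (src≢v f∈B)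
        ... | inj₂ (inj₂ (_ , s′≡v)) = contradiction s′≡v (src≢v f′∈B)

        tgt-inj : TgtInjective C B
        tgt-inj {f} {f′} f∈B f′∈B eq
          with mergeVertex-cases (trans (sym (proj₂ (ends f∈B))) (trans eq (proj₂ (ends f′∈B))))
        ... | inj₁ t≡t′              =
              punchIn-injective e f f′ (tgt-injective mp (punchIn∈B⁺ f∈B) (punchIn∈B⁺ f′∈B) t≡t′)
        ... | inj₂ (inj₁ (_ , t′≡w)) = contradiction t′≡w (tgt≢w f′∈B)
        ... | inj₂ (inj₂ (t≡w , _))  = contradiction t≡w (tgt≢w f∈B)

        lift-walk : ∀ n {a b′} → a ≢ v → walk C B n (just (merge a)) ≡ just b′ →
                    ∃ λ m → ∃ λ b → n ≤ m × b ≢ v × merge b ≡ b′ × walk G B⁺ m (just a) ≡ just b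
        lift-walk zero    {a} a≢v refl = 0 , a , z≤n , a≢v , refl , refl
        lift-walk (suc n) {a} {b′} a≢v walk≡ with nextB C B (merge a) in step
        ... | nothing = contradiction (trans (sym (walk-nothing C B n)) walk≡) λ ()
        ... | just c with nextB-just C step
        ...   | f , f∈B , src-f , refl = continue (tgt G (punchIn e f) ≟ v)
          where
          stepᴳ : nextB G B⁺ a ≡ just (tgt G (punchIn e f))
          stepᴳ = nextB-edge G (src-injective mp) (punchIn e f , punchIn∈B⁺ f∈B ,
                    mergeVertex-injective-off-v (src≢v f∈B) a≢v (trans (sym (proj₁ (ends f∈B))) src-f) , refl)
          rest : ∀ {u} → merge u ≡ tgt C f → walk C B n (just (merge u)) ≡ just b′
          rest u≡ = trans (cong (λ z → walk C B n (just z)) u≡) walk≡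
          continue : Dec (tgt G (punchIn e f) ≡ v) →
                     ∃ λ m → ∃ λ b → suc n ≤ m × b ≢ v × merge b ≡ b′ × walk G B⁺ m (just a) ≡ just b
          continue (no t≢v) with lift-walk n t≢v (rest (sym (proj₂ (ends f∈B))))
          ... | m , b , n≤m , b≢v , mb , walkᴳ =
                suc m , b , s≤s n≤m , b≢v , mb , trans (cong (walk G B⁺ m) stepᴳ) walkᴳ
          continue (yes t≡v)
            with lift-walk n w≢v (rest (trans mergeVertex-tgt (trans (cong merge (sym t≡v))
                                                                      (sym (proj₂ (ends f∈B))))))
          ... | m , b , n≤m , b≢v , mb , walkᴳ =
                suc (suc m) , b , s≤s (ℕ.m≤n⇒m≤1+n n≤m) , b≢v , mb ,
                trans (cong (walk G B⁺ (suc m)) (trans stepᴳ (cong just t≡v)))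
                      (trans (cong (walk G B⁺ m) e-step) walkᴳ)

        no-cycle : Acyclic C B
        no-cycle c n closed with mergeVertex-onto-off-v c
        ... | a , a≢v , refl with lift-walk (suc n) a≢v closed
        ...   | suc m , b , _ , b≢v , mb , walkᴳ =
                acyclic mp a m (trans walkᴳ (cong just (mergeVertex-injective-off-v b≢v a≢v mb)))

    contraction⇒insertion : Multipath C B → Multipath G B⁺
    contraction⇒insertion mp = record
      { loopless      = no-loop
      ; src-injective = end-injective src src≢v (proj₁ ∘ ends) (src-injective mp)
      ; tgt-injective = end-injective tgt tgt≢w (proj₂ ∘ ends) (tgt-injective mp)
      ; acyclic       = no-cycle
      }
      where open FromContraction mp

    insertion⇒contraction : Multipath G B⁺ → Multipath C B
    insertion⇒contraction mp = record
      { loopless      = no-loop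
      ; src-injective = src-inj
      ; tgt-injective = tgt-inj
      ; acyclic       = no-cycle
      }
      where open FromInsertion mp

    Multipath-contract : Multipath C B ⇔ Multipath G B⁺
    Multipath-contract = mk⇔ contraction⇒insertion insertion⇒contraction

module _ {V E : ℕ} (G : Digraph V E) where

  open import Data.Nat using (_+_; _*_)

  NoEdgeFrom NoEdgeInto : Subset E → Fin V → Set
  NoEdgeFrom K a = ∀ {f} → f ∈ K → src G f ≢ a
  NoEdgeInto K b = ∀ {f} → f ∈ K → tgt G f ≢ b

  ¬∃⇒NoEdgeInto : ∀ {K b} → ¬ (∃ λ f → f ∈ K × tgt G f ≡ b) → NoEdgeInto K b
  ¬∃⇒NoEdgeInto none {f} f∈ tgt-f = none (f , f∈ , tgt-f)

  Path : Subset E → Fin V → Fin V → Set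
  Path K b a = ∃ λ m → walk G K m (just b) ≡ just a

  module _ {K : Subset E} {g : Fin E} (from-free : NoEdgeFrom K (src G g)) where

    private
      a b : Fin V
      a = src G g
      b = tgt G g

      K′ : Subset E
      K′ = K ∪ ⁅ g ⁆

    g∉K : g ∉ K
    g∉K g∈K = from-free g∈K refl

    ∣K∪⁅g⁆∣ : ∣ K′ ∣ ≡ suc ∣ K ∣
    ∣K∪⁅g⁆∣ = ∣p∪⁅y⁆∣≡1+∣p∣ K g∉K

    src-injective-∪⁅⁆ : SrcInjective G K → SrcInjective G K′
    src-injective-∪⁅⁆ inj f∈ h∈ eq with x∈p∪⁅y⁆⁻ K f∈ | x∈p∪⁅y⁆⁻ K h∈
    ... | inj₁ refl | inj₁ refl = refl
    ... | inj₁ refl | inj₂ h∈K  = contradiction (sym eq) (from-free h∈K)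
    ... | inj₂ f∈K  | inj₁ refl = contradiction eq (from-free f∈K)
    ... | inj₂ f∈K  | inj₂ h∈K  = inj f∈K h∈K eq

    nextB-∪⁅⁆ : SrcInjective G K′ → ∀ {c} → c ≢ a → nextB G K′ c ≡ nextB G K c
    nextB-∪⁅⁆ inj {c} c≢a = sym (nextB-cong G G inj add-g drop-g)
      where
      add-g : ∀ {d} → Edge G K c d → Edge G K′ c d
      add-g (f , f∈ , s , t) = f , p⊆p∪⁅y⁆ K f∈ , s , t
      drop-g : ∀ {d} → Edge G K′ c d → Edge G K c d
      drop-g (f , f∈ , s , t) with x∈p∪⁅y⁆⁻ K f∈
      ... | inj₁ refl = contradiction (sym s) c≢a
      ... | inj₂ f∈K  = f , f∈K , s , t

    walk-∪⁅⁆ : SrcInjective G K′ → ∀ n c {d} → walk G K′ n (just c) ≡ just d →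
               Path K c a ⊎ walk G K n (just c) ≡ just d
    walk-∪⁅⁆ inj zero    c eq = inj₂ eq
    walk-∪⁅⁆ inj (suc n) c eq with c ≟ a
    ... | yes refl = inj₁ (0 , refl)
    ... | no c≢a with nextB G K′ c | nextB-∪⁅⁆ inj c≢a
    ...   | _ | refl with nextB G K c in step
    ...     | nothing = contradiction (trans (sym (walk-nothing G K′ n)) eq) λ ()
    ...     | just t with walk-∪⁅⁆ inj n t eq
    ...       | inj₁ (m , reach) = inj₁ (suc m , trans (cong (walk G K m) step) reach)
    ...       | inj₂ walkᴷ       = inj₂ walkᴷ

    closed-walk⇒Path : Acyclic G K → SrcInjective G K′ → ∀ c n →
                       walk G K′ (suc n) (just c) ≡ just c → Path K b a
    closed-walk⇒Path acyclicᴷ inj c n closed with walk-∪⁅⁆ inj (suc n) c closed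
    ... | inj₂ closedᴷ = contradiction closedᴷ (acyclicᴷ c n)
    ... | inj₁ (m , c⟶a) with walk-∪⁅⁆ inj n b b⟶a
      where
      c⟶′a : walk G K′ m (just c) ≡ just a
      c⟶′a = walk-mono G inj (p⊆p∪⁅y⁆ K) m (just c) c⟶a
      a⟶′a : walk G K′ (suc n) (just a) ≡ just a
      a⟶′a = begin
        walk G K′ (suc n) (just a)                      ≡⟨ cong (walk G K′ (suc n)) c⟶′a ⟨
        walk G K′ (suc n) (walk G K′ m (just c))        ≡⟨ walk-+ G K′ m (suc n) (just c) ⟨
        walk G K′ (m + suc n) (just c)                  ≡⟨ cong (λ l → walk G K′ l (just c)) (ℕ.+-comm m _) ⟩
        walk G K′ (suc n + m) (just c)                  ≡⟨ walk-+ G K′ (suc n) m (just c) ⟩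
        walk G K′ m (walk G K′ (suc n) (just c))        ≡⟨ cong (walk G K′ m) closed ⟩
        walk G K′ m (just c)                            ≡⟨ c⟶′a ⟩
        just a                                          ∎
        where open ≡-Reasoning
      b⟶a : walk G K′ n (just b) ≡ just a
      b⟶a = trans (cong (walk G K′ n) (sym (nextB-edge G inj (g , y∈p∪⁅y⁆ K , refl , refl)))) a⟶′a
    ...   | inj₁ path = path
    ...   | inj₂ b⟶a  = n , b⟶a

    extend-or-Path : Multipath G K → a ≢ b → NoEdgeInto K b → Multipath G K′ ⊎ Path K b a
    extend-or-Path mp a≢b into-free with acyclic-or-cycle G K′
    ... | inj₁ acyclic′ = inj₁ record
      { loopless      = no-loop
      ; src-injective = src-inj
      ; tgt-injective = tgt-inj
      ; acyclic       = acyclic′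
      }
      where
      no-loop : ∀ {f} → f ∈ K′ → src G f ≢ tgt G f
      no-loop f∈ with x∈p∪⁅y⁆⁻ K f∈
      ... | inj₁ refl = a≢b
      ... | inj₂ f∈K  = loopless mp f∈K
      src-inj : SrcInjective G K′
      src-inj = src-injective-∪⁅⁆ (src-injective mp)
      tgt-inj : TgtInjective G K′
      tgt-inj f∈ h∈ eq with x∈p∪⁅y⁆⁻ K f∈ | x∈p∪⁅y⁆⁻ K h∈
      ... | inj₁ refl | inj₁ refl = refl
      ... | inj₁ refl | inj₂ h∈K  = contradiction (sym eq) (into-free h∈K)
      ... | inj₂ f∈K  | inj₁ refl = contradiction eq (into-free f∈K)
      ... | inj₂ f∈K  | inj₂ h∈K  = tgt-injective mp f∈K h∈K eq
    ... | inj₂ (c , n , closed) =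
          inj₂ (closed-walk⇒Path (acyclic mp) (src-injective-∪⁅⁆ (src-injective mp)) c n closed)

    Multipath-∪⁅⁆ : Multipath G K → a ≢ b → NoEdgeInto K b → ¬ Path K b a → Multipath G K′
    Multipath-∪⁅⁆ mp a≢b into-free no-path with extend-or-Path mp a≢b into-free
    ... | inj₁ mp′  = mp′
    ... | inj₂ path = contradiction path no-path

cyc-last : ∀ {k} (j : Fin (suc (suc k))) → toℕ j ≡ suc k → cyc j ≡ zero
cyc-last {k} j j≡ with suc k ℕ.≟ toℕ j
... | yes _ = refl
... | no ≢  = contradiction (sym j≡) ≢

toℕ-cyc : ∀ {k} (j : Fin (suc (suc k))) → toℕ j ≢ suc k → toℕ (cyc j) ≡ suc (toℕ j)
toℕ-cyc {k} j j≢ with suc k ℕ.≟ toℕ j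
... | yes ≡ = contradiction (sym ≡) j≢
... | no ≢  = cong suc (toℕ-lower₁ j ≢)

-- The path from b to a followed by h is a directed cycle, hence by (MP2) a whole component:
-- every edge with an endpoint on the path is one of its edges.
module PathClosedByEdge {V E : ℕ} (G : Digraph V E) (mp2 : MP2 G) {K : Subset E} (mp : Multipath G K)
                        {b a : Fin V} {k : ℕ} (path : walk G K (suc k) (just b) ≡ just a)
                        {h : Fin E} (src-h : src G h ≡ a) (tgt-h : tgt G h ≡ b) where

  open import Data.Nat using (_+_)

  vertex : ℕ → Fin V
  vertex = position G K b

  walk-vertex : ∀ {i} → i ≤ suc k → walk G K i (just b) ≡ just (vertex i)
  walk-vertex i≤ = walk-position G K i≤ path

  vertex-last : vertex (suc k) ≡ a
  vertex-last = just-injective (trans (sym (walk-vertex ℕ.≤-refl)) path)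

  vertex-step : ∀ {i} → i < suc k → nextB G K (vertex i) ≡ just (vertex (suc i))
  vertex-step {i} i< = begin
    nextB G K (vertex i)               ≡⟨ cong (walk G K 1) (walk-vertex (ℕ.<⇒≤ i<)) ⟨
    walk G K 1 (walk G K i (just b))   ≡⟨ walk-step G K i b ⟨
    walk G K (suc i) (just b)          ≡⟨ walk-vertex i< ⟩
    just (vertex (suc i))              ∎
    where open ≡-Reasoning

  private
    vertex-distinct : ∀ {i j} → i < j → j ≤ suc k → vertex i ≢ vertex j
    vertex-distinct {i} i<j j≤ eq with ℕ.m≤n⇒∃[o]m+o≡n i<j
    ... | d , refl = acyclic mp (vertex i) d (begin
      walk G K (suc d) (just (vertex i))         ≡⟨ cong (walk G K (suc d)) (walk-vertex i≤) ⟨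
      walk G K (suc d) (walk G K i (just b))     ≡⟨ walk-+ G K i (suc d) (just b) ⟨
      walk G K (i + suc d) (just b)              ≡⟨ cong (λ l → walk G K l (just b)) (ℕ.+-suc i d) ⟩
      walk G K (suc i + d) (just b)              ≡⟨ walk-vertex j≤ ⟩
      just (vertex (suc i + d))                  ≡⟨ cong just eq ⟨
      just (vertex i)                            ∎)
      where
      open ≡-Reasoning
      i≤ : i ≤ suc k
      i≤ = ℕ.≤-trans (ℕ.<⇒≤ i<j) j≤

  vertex-injective : ∀ {i j} → i ≤ suc k → j ≤ suc k → vertex i ≡ vertex j → i ≡ j
  vertex-injective {i} {j} i≤ j≤ eq with ℕ.<-cmp i j
  ... | tri< i<j _ _ = contradiction eq (vertex-distinct i<j j≤)
  ... | tri≈ _ i≡j _ = i≡j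
  ... | tri> _ _ j<i = contradiction (sym eq) (vertex-distinct j<i i≤)

  private
    u : Fin (suc (suc k)) → Fin V
    u j = vertex (toℕ j)

    toℕ≤ : ∀ (j : Fin (suc (suc k))) → toℕ j ≤ suc k
    toℕ≤ j = ℕ.≤-pred (toℕ<n j)

    u-injective : ∀ i j → u i ≡ u j → i ≡ j
    u-injective i j = toℕ-injective ∘ vertex-injective (toℕ≤ i) (toℕ≤ j)

    cycle-edge : ∀ j → HasEdge G (u j) (u (cyc j))
    cycle-edge j with toℕ j ℕ.≟ suc k
    ... | yes last = h , trans src-h (trans (sym vertex-last) (cong vertex (sym last)))
                       , trans tgt-h (cong u (sym (cyc-last j last)))
    ... | no ¬last with nextB-just G {K} (vertex-step (ℕ.≤∧≢⇒< (toℕ≤ j) ¬last))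
    ...   | f , _ , src-f , tgt-f = f , src-f , trans tgt-f (cong vertex (sym (toℕ-cyc j ¬last)))

    component : IsComponentCycle G k u
    component = mp2 k u (u-injective , cycle-edge)

    out-of-cycle : ∀ {f} j → src G f ≡ u j → tgt G f ≡ u (cyc j)
    out-of-cycle {f} j src≡ with component f (inj₁ (j , src≡))
    ... | j′ , src≡′ , tgt≡ with u-injective j j′ (trans (sym src≡) src≡′)
    ...   | refl = tgt≡

    into-cycle : ∀ {f} j → tgt G f ≡ u j → ∃ λ j′ → src G f ≡ u j′ × cyc j′ ≡ j
    into-cycle {f} j tgt≡ with component f (inj₂ (j , tgt≡))
    ... | j′ , src≡ , tgt≡′ = j′ , src≡ , u-injective (cyc j′) j (trans (sym tgt≡′) tgt≡)

    index : ∀ {i} → i ≤ suc k → Fin (suc (suc k))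
    index i≤ = fromℕ< (s≤s i≤)

    toℕ-index : ∀ {i} (i≤ : i ≤ suc k) → toℕ (index i≤) ≡ i
    toℕ-index i≤ = toℕ-fromℕ< (s≤s i≤)

    u-index : ∀ {i} (i≤ : i ≤ suc k) → u (index i≤) ≡ vertex i
    u-index i≤ = cong vertex (toℕ-index i≤)

    toℕ-cyc⁻ : ∀ j {i} → toℕ (cyc j) ≡ suc i → toℕ j ≡ i
    toℕ-cyc⁻ j eq with toℕ j ℕ.≟ suc k
    ... | yes last = contradiction (trans (cong toℕ (sym (cyc-last j last))) eq) λ ()
    ... | no ¬last = ℕ.suc-injective (trans (sym (toℕ-cyc j ¬last)) eq)

  out-of-vertex : ∀ {f i} → i < suc k → src G f ≡ vertex i → tgt G f ≡ vertex (suc i)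
  out-of-vertex {f} {i} i< src≡ = begin
    tgt G f               ≡⟨ out-of-cycle j (trans src≡ (sym (u-index i≤))) ⟩
    u (cyc j)             ≡⟨ cong vertex (toℕ-cyc j (ℕ.<⇒≢ i< ∘ trans (sym (toℕ-index i≤)))) ⟩
    vertex (suc (toℕ j))  ≡⟨ cong (vertex ∘ suc) (toℕ-index i≤) ⟩
    vertex (suc i)        ∎
    where
    open ≡-Reasoning
    i≤ : i ≤ suc k
    i≤ = ℕ.<⇒≤ i<
    j : Fin (suc (suc k))
    j = index i≤

  out-of-last : ∀ {f} → src G f ≡ a → tgt G f ≡ b
  out-of-last src≡ = trans (out-of-cycle last (trans src≡ (trans (sym vertex-last) (sym (u-index ℕ.≤-refl)))))
                           (cong u (cyc-last last (toℕ-index ℕ.≤-refl)))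
    where
    last : Fin (suc (suc k))
    last = index ℕ.≤-refl

  into-vertex : ∀ {f i} → i < suc k → tgt G f ≡ vertex (suc i) → src G f ≡ vertex i
  into-vertex i< tgt≡ with into-cycle (index i<) (trans tgt≡ (sym (u-index i<)))
  ... | j′ , src≡ , cyc≡ = trans src≡ (cong vertex (toℕ-cyc⁻ j′ (trans (cong toℕ cyc≡) (toℕ-index i<))))

  into-first : ∀ {f} → tgt G f ≡ b → src G f ≡ a
  into-first tgt≡ with into-cycle zero tgt≡
  ... | j′ , src≡ , cyc≡ with toℕ j′ ℕ.≟ suc k
  ...   | yes last = trans src≡ (trans (cong vertex last) vertex-last)
  ...   | no ¬last = contradiction (trans (sym (toℕ-cyc j′ ¬last)) (cong toℕ cyc≡)) λ ()

-- Exchange in MP-digraphs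

module _ {V E : ℕ} (G : Digraph V E) (mpG : IsMPDigraph G) (e : Fin E) (nl : src G e ≢ tgt G e) where

  private
    v w : Fin V
    v = src G e
    w = tgt G e

    mp1 : MP1 G
    mp1 = proj₁ (proj₂ mpG)

    mp2 : MP2 G
    mp2 = proj₂ (proj₂ mpG)

    parallel : ∀ {f} → src G f ≡ v → tgt G f ≡ w → f ≡ e
    parallel src≡ tgt≡ = sym (proj₁ mpG e _ nl (sym src≡) (sym tgt≡))

    edge : ∀ f → HasEdge G (src G f) (tgt G f)
    edge f = f , refl , refl

    no-DA : ∀ v₀ v₁ v₂ → v₀ ≢ v₁ → v₀ ≢ v₂ → v₁ ≢ v₂ →
            HasEdge G v₁ v₀ → HasEdge G v₀ v₂ → ¬ HasEdge G v₁ v₂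
    no-DA v₀ v₁ v₂ p q r x y z = proj₁ mp1 (v₀ , v₁ , v₂ , p , q , r , x , y , z)

    no-DB : ∀ v₀ v₁ v₂ v₃ → v₀ ≢ v₁ → v₀ ≢ v₂ → v₀ ≢ v₃ → v₁ ≢ v₂ → v₁ ≢ v₃ → v₂ ≢ v₃ →
            HasEdge G v₀ v₁ → HasEdge G v₂ v₁ → ¬ HasEdge G v₂ v₃
    no-DB v₀ v₁ v₂ v₃ p q r s t u x y z =
      proj₁ (proj₂ (proj₂ mp1)) (v₀ , v₁ , v₂ , v₃ , p , q , r , s , t , u , x , y , z)

    no-DBʳ : ∀ v₀ v₁ v₂ v₃ → v₀ ≢ v₁ → v₀ ≢ v₂ → v₀ ≢ v₃ → v₁ ≢ v₂ → v₁ ≢ v₃ → v₂ ≢ v₃ →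
             HasEdge G v₁ v₀ → HasEdge G v₁ v₂ → ¬ HasEdge G v₃ v₂
    no-DBʳ v₀ v₁ v₂ v₃ p q r s t u x y z =
      proj₂ (proj₂ (proj₂ mp1)) (v₀ , v₁ , v₂ , v₃ , p , q , r , s , t , u , x , y , z)

    ∈-minus : ∀ {J : Subset E} {x f} → f ∈ J ─ ⁅ x ⁆ → f ≢ x × f ∈ J
    ∈-minus {J} = x∈p─⁅y⁆⁻ J

    Multipath-minus : ∀ {J} x → Multipath G J → Multipath G (J ─ ⁅ x ⁆)
    Multipath-minus x mpJ = Multipath-⊆ G mpJ (proj₂ ∘ ∈-minus)

    no-trivial-path : just w ≢ just v
    no-trivial-path w≡v = nl (sym (just-injective w≡v))

    EntersFrom : Subset E → Set
    EntersFrom J = ∃ λ J′ → Multipath G J′ × e ∈ J′ × J′ ⊆ J ∪ ⁅ e ⁆ × ∣ J ∣ ≤ ∣ J′ ∣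

    swap-in : ∀ {J x} → Multipath G J → x ∈ J →
              NoEdgeFrom G (J ─ ⁅ x ⁆) v → NoEdgeInto G (J ─ ⁅ x ⁆) w → ¬ Path G (J ─ ⁅ x ⁆) w v →
              EntersFrom J
    swap-in {J} {x} mpJ x∈J from-free into-free no-path =
        (J ─ ⁅ x ⁆) ∪ ⁅ e ⁆
      , Multipath-∪⁅⁆ G from-free (Multipath-minus x mpJ) nl into-free no-path
      , y∈p∪⁅y⁆ (J ─ ⁅ x ⁆)
      , p∪⁅y⁆⊆q (p⊆p∪⁅y⁆ J ∘ proj₂ ∘ ∈-minus) (y∈p∪⁅y⁆ J)
      , ℕ.≤-reflexive (trans (sym (1+∣p─⁅y⁆∣≡∣p∣ J x∈J)) (sym (∣K∪⁅g⁆∣ G from-free)))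

    enter-replacing-out-edge : ∀ {J f} → Multipath G J → e ∉ J → f ∈ J → src G f ≡ v → EntersFrom J
    enter-replacing-out-edge {J} {f} mpJ e∉J f∈J src-f = swap-in mpJ f∈J from-free into-free no-path
      where
      a′ : Fin V
      a′ = tgt G f
      a′≢w : a′ ≢ w
      a′≢w = x∈p∧y∉p⇒x≢y f∈J e∉J ∘ parallel src-f
      a′≢v : a′ ≢ v
      a′≢v a′≡v = loopless mpJ f∈J (trans src-f (sym a′≡v))
      from-free : NoEdgeFrom G (J ─ ⁅ f ⁆) v
      from-free g∈ src-g with ∈-minus g∈
      ... | g≢f , g∈J = g≢f (src-injective mpJ g∈J f∈J (trans src-g (sym src-f)))
      into-free : NoEdgeInto G (J ─ ⁅ f ⁆) w
      into-free {g} g∈ tgt-g with ∈-minus g∈ | src G g ≟ v | src G g ≟ a′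
      ... | _ , g∈J | yes src-g | _         = x∈p∧y∉p⇒x≢y g∈J e∉J (parallel src-g tgt-g)
      ... | _ , g∈J | no _      | yes src-g =
            no-DA a′ v w a′≢v a′≢w nl (f , src-f , refl) (g , src-g , tgt-g) (edge e)
      ... | _ , g∈J | no s≢v    | no s≢a′   =
            no-DB (src G g) w v a′ (λ s≡w → loopless mpJ g∈J (trans s≡w (sym tgt-g))) s≢v s≢a′
                  (nl ∘ sym) (a′≢w ∘ sym) (a′≢v ∘ sym) (g , refl , tgt-g) (edge e) (f , src-f , refl)
      no-path : ¬ Path G (J ─ ⁅ f ⁆) w v
      no-path (zero  , w≡v)  = no-trivial-path w≡v
      no-path (suc k , path) = a′≢w (out-of-last src-f)
        where open PathClosedByEdge G mp2 (Multipath-minus f mpJ) {k = k} path refl refl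

    enter-replacing-in-edge : ∀ {J g} → Multipath G J → e ∉ J → NoEdgeFrom G J v → g ∈ J → tgt G g ≡ w →
                              EntersFrom J
    enter-replacing-in-edge {J} {g} mpJ e∉J from-free-J g∈J tgt-g = swap-in mpJ g∈J from-free into-free no-path
      where
      from-free : NoEdgeFrom G (J ─ ⁅ g ⁆) v
      from-free = from-free-J ∘ proj₂ ∘ ∈-minus
      into-free : NoEdgeInto G (J ─ ⁅ g ⁆) w
      into-free f∈ tgt-f with ∈-minus f∈
      ... | f≢g , f∈J = f≢g (tgt-injective mpJ f∈J g∈J (trans tgt-f (sym tgt-g)))
      no-path : ¬ Path G (J ─ ⁅ g ⁆) w v
      no-path (zero  , w≡v)  = no-trivial-path w≡v
      no-path (suc k , path) = x∈p∧y∉p⇒x≢y g∈J e∉J (parallel (into-first tgt-g) tgt-g)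
        where open PathClosedByEdge G mp2 (Multipath-minus g mpJ) {k = k} path refl refl

    enter-cutting-path : ∀ {J m} → Multipath G J → NoEdgeFrom G J v → NoEdgeInto G J w →
                         walk G J (suc m) (just w) ≡ just v → EntersFrom J
    enter-cutting-path {J} {m} mpJ from-free-J into-free-J path with walk-first-edge G m path
    ... | h , h∈J , src-h =
          swap-in mpJ h∈J (from-free-J ∘ proj₂ ∘ ∈-minus) (into-free-J ∘ proj₂ ∘ ∈-minus) no-path
      where
      no-path : ¬ Path G (J ─ ⁅ h ⁆) w v
      no-path (zero  , w≡v)  = no-trivial-path w≡v
      no-path (suc k , path′) with walk-first-edge G k path′
      ... | f , f∈ , src-f with ∈-minus f∈
      ...   | f≢h , f∈J = f≢h (src-injective mpJ f∈J h∈J (trans src-f (sym src-h)))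

  exchange-in : ∀ {J} → Multipath G J → e ∉ J →
                ∃ λ J′ → Multipath G J′ × e ∈ J′ × J′ ⊆ J ∪ ⁅ e ⁆ × ∣ J ∣ ≤ ∣ J′ ∣
  exchange-in {J} mpJ e∉J with nextB G J v in out
  ... | just _ with nextB-just G out
  ...   | f , f∈J , src-f , _ = enter-replacing-out-edge mpJ e∉J f∈J src-f
  exchange-in {J} mpJ e∉J | nothing with any? (λ g → (g ∈? J) ×-dec (tgt G g ≟ w))
  ... | yes (g , g∈J , tgt-g) = enter-replacing-in-edge mpJ e∉J (nextB-nothing G out) g∈J tgt-g
  ... | no no-in with extend-or-Path G (nextB-nothing G out) mpJ nl (¬∃⇒NoEdgeInto G no-in)
  ...   | inj₁ mp′            = J ∪ ⁅ e ⁆ , mp′ , y∈p∪⁅y⁆ J , ⊆-refl , ∣p∣≤∣p∪q∣ J ⁅ e ⁆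
  ...   | inj₂ (zero  , w≡v)  = contradiction w≡v no-trivial-path
  ...   | inj₂ (suc m , path) =
          enter-cutting-path {m = m} mpJ (nextB-nothing G out) (¬∃⇒NoEdgeInto G no-in) path

  private
    LeavesFrom : Subset E → Set
    LeavesFrom J = ∃ λ J′ → Multipath G J′ × e ∉ J′ × ∣ J ∣ ≤ ∣ J′ ∣

    swap-out : ∀ {J g} → Multipath G J → e ∈ J → g ≢ e → src G g ≢ tgt G g →
               NoEdgeFrom G (J ─ ⁅ e ⁆) (src G g) → NoEdgeInto G (J ─ ⁅ e ⁆) (tgt G g) →
               ¬ Path G (J ─ ⁅ e ⁆) (tgt G g) (src G g) → LeavesFrom J
    swap-out {J} {g} mpJ e∈J g≢e g-nl from-free into-free no-path =
        (J ─ ⁅ e ⁆) ∪ ⁅ g ⁆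
      , Multipath-∪⁅⁆ G from-free (Multipath-minus e mpJ) g-nl into-free no-path
      , e∉
      , ℕ.≤-reflexive (trans (sym (1+∣p─⁅y⁆∣≡∣p∣ J e∈J)) (sym (∣K∪⁅g⁆∣ G from-free)))
      where
      e∉ : e ∉ (J ─ ⁅ e ⁆) ∪ ⁅ g ⁆
      e∉ e∈ with x∈p∪⁅y⁆⁻ (J ─ ⁅ e ⁆) e∈
      ... | inj₁ e≡g   = g≢e (sym e≡g)
      ... | inj₂ e∈J-e = proj₁ (∈-minus e∈J-e) refl

    minus-e-from-v : ∀ {J} → Multipath G J → e ∈ J → NoEdgeFrom G (J ─ ⁅ e ⁆) v
    minus-e-from-v mpJ e∈J f∈ src-f with ∈-minus f∈
    ... | f≢e , f∈J = f≢e (src-injective mpJ f∈J e∈J src-f)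

    minus-e-into-w : ∀ {J} → Multipath G J → e ∈ J → NoEdgeInto G (J ─ ⁅ e ⁆) w
    minus-e-into-w mpJ e∈J f∈ tgt-f with ∈-minus f∈
    ... | f≢e , f∈J = f≢e (tgt-injective mpJ f∈J e∈J tgt-f)

    leave-along-out-edge : ∀ {B J h} → Multipath G B → e ∉ B → h ∈ B → src G h ≡ v →
                           Multipath G J → e ∈ J → LeavesFrom J
    leave-along-out-edge {B} {J} {h} mpB e∉B h∈B src-h mpJ e∈J =
      swap-out mpJ e∈J (x∈p∧y∉p⇒x≢y h∈B e∉B) (loopless mpB h∈B) from-free into-free no-path
      where
      a′ : Fin V
      a′ = tgt G h
      a′≢w : a′ ≢ w
      a′≢w = x∈p∧y∉p⇒x≢y h∈B e∉B ∘ parallel src-h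
      a′≢v : a′ ≢ v
      a′≢v a′≡v = loopless mpB h∈B (trans src-h (sym a′≡v))
      from-free : NoEdgeFrom G (J ─ ⁅ e ⁆) (src G h)
      from-free f∈ src-f = minus-e-from-v mpJ e∈J f∈ (trans src-f src-h)
      into-free : NoEdgeInto G (J ─ ⁅ e ⁆) a′
      into-free {f} f∈ tgt-f with ∈-minus f∈ | src G f ≟ w | src G f ≟ v
      ... | _ , f∈J | yes src-f | _         =
            no-DA w v a′ (nl ∘ sym) (a′≢w ∘ sym) (a′≢v ∘ sym) (edge e) (f , src-f , tgt-f) (h , src-h , refl)
      ... | _ , _   | no _      | yes src-f = minus-e-from-v mpJ e∈J f∈ src-f
      ... | _ , f∈J | no s≢w    | no s≢v    =
            no-DBʳ w v a′ (src G f) (nl ∘ sym) (a′≢w ∘ sym) (s≢w ∘ sym) (a′≢v ∘ sym) (s≢v ∘ sym)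
                   (λ a′≡s → loopless mpJ f∈J (trans (sym a′≡s) (sym tgt-f)))
                   (edge e) (h , src-h , refl) (f , refl , tgt-f)
      no-path : ¬ Path G (J ─ ⁅ e ⁆) a′ (src G h)
      no-path (zero  , a′≡s)  = a′≢v (trans (just-injective a′≡s) src-h)
      no-path (suc k , path) = a′≢w (sym (out-of-last {e} (sym src-h)))
        where open PathClosedByEdge G mp2 (Multipath-minus e mpJ) {k = k} path {h} refl refl

    leave-along-in-edge : ∀ {B J h} → Multipath G B → e ∉ B → h ∈ B → tgt G h ≡ w →
                          Multipath G J → e ∈ J → LeavesFrom J
    leave-along-in-edge {B} {J} {h} mpB e∉B h∈B tgt-h mpJ e∈J =
      swap-out mpJ e∈J (x∈p∧y∉p⇒x≢y h∈B e∉B) (loopless mpB h∈B) from-free into-free no-path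
      where
      b′ : Fin V
      b′ = src G h
      b′≢v : b′ ≢ v
      b′≢v src-h = x∈p∧y∉p⇒x≢y h∈B e∉B (parallel src-h tgt-h)
      b′≢w : b′ ≢ w
      b′≢w b′≡w = loopless mpB h∈B (trans b′≡w (sym tgt-h))
      from-free : NoEdgeFrom G (J ─ ⁅ e ⁆) b′
      from-free {f} f∈ src-f with ∈-minus f∈ | tgt G f ≟ v | tgt G f ≟ w
      ... | _ , _   | yes tgt-f | _         =
            no-DA v b′ w (b′≢v ∘ sym) nl b′≢w (f , src-f , tgt-f) (edge e) (h , refl , tgt-h)
      ... | _ , _   | no _      | yes tgt-f = minus-e-into-w mpJ e∈J f∈ tgt-f
      ... | _ , f∈J | no t≢v    | no t≢w    =
            no-DB v w b′ (tgt G f) nl (b′≢v ∘ sym) (t≢v ∘ sym) (b′≢w ∘ sym) (t≢w ∘ sym)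
                  (λ b′≡t → loopless mpJ f∈J (trans src-f b′≡t)) (edge e) (h , refl , tgt-h) (f , src-f , refl)
      into-free : NoEdgeInto G (J ─ ⁅ e ⁆) (tgt G h)
      into-free f∈ tgt-f = minus-e-into-w mpJ e∈J f∈ (trans tgt-f tgt-h)
      no-path : ¬ Path G (J ─ ⁅ e ⁆) (tgt G h) b′
      no-path (zero  , t≡b′)  = b′≢w (trans (sym (just-injective t≡b′)) tgt-h)
      no-path (suc k , path) = b′≢v (sym (into-first {e} (sym tgt-h)))
        where open PathClosedByEdge G mp2 (Multipath-minus e mpJ) {k = k} path {h} refl refl

    -- B has a path from w to v, which e closes into a cycle. J cannot take every step of the path
    -- (it would contain a cycle through e); the last path edge whose step J does not take replaces e,
    -- and (MP2) keeps the walks of J ─ ⁅ e ⁆ from its target on the later part of the path.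
    module AlongPath {B J : Subset E} {k : ℕ} (mpB : Multipath G B) (e∉B : e ∉ B)
                     (mpJ : Multipath G J) (e∈J : e ∈ J) (path : walk G B (suc k) (just w) ≡ just v) where

      open PathClosedByEdge G mp2 mpB {k = k} path {e} refl refl

      K : Subset E
      K = J ─ ⁅ e ⁆

      JStep : ℕ → Set
      JStep i = nextB G J (vertex i) ≡ just (vertex (suc i))

      J-walk-along : (∀ {i} → i < suc k → JStep i) → ∀ {i} → i ≤ suc k →
                     walk G J i (just w) ≡ just (vertex i)
      J-walk-along steps {zero}  _  = refl
      J-walk-along steps {suc i} i< = begin
        walk G J (suc i) (just w)           ≡⟨ walk-step G J i w ⟩
        walk G J 1 (walk G J i (just w))    ≡⟨ cong (walk G J 1) (J-walk-along steps (ℕ.<⇒≤ i<)) ⟩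
        nextB G J (vertex i)                ≡⟨ steps i< ⟩
        just (vertex (suc i))               ∎
        where open ≡-Reasoning

      not-all-steps : ¬ (∀ {i} → i < suc k → JStep i)
      not-all-steps steps = acyclic mpJ w (suc k) (begin
        walk G J (suc (suc k)) (just w)          ≡⟨ walk-step G J (suc k) w ⟩
        walk G J 1 (walk G J (suc k) (just w))   ≡⟨ cong (walk G J 1) (J-walk-along steps ℕ.≤-refl) ⟩
        nextB G J (vertex (suc k))               ≡⟨ cong (nextB G J) vertex-last ⟩
        nextB G J v                              ≡⟨ nextB-edge G (src-injective mpJ) (e , e∈J , refl , refl) ⟩
        just w                                   ∎)
        where open ≡-Reasoning

      J-step-of : ∀ {f} i → f ∈ K → src G f ≡ vertex i → nextB G J (vertex i) ≡ just (tgt G f)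
      J-step-of i f∈ src-f = nextB-edge G (src-injective mpJ) (_ , proj₂ (∈-minus f∈) , src-f , refl)

      stays-beyond : ∀ {i} → (∀ {j} → i < j → j < suc k → JStep j) →
                     ∀ m {j₀ x} → i < j₀ → j₀ ≤ suc k → walk G K m (just (vertex j₀)) ≡ just x →
                     ∃ λ j → i < j × j ≤ suc k × x ≡ vertex j
      stays-beyond later zero    {j₀} i<j₀ j₀≤ refl = j₀ , i<j₀ , j₀≤ , refl
      stays-beyond later (suc m) {j₀} i<j₀ j₀≤ reach with nextB G K (vertex j₀) in step
      ... | nothing = contradiction (trans (sym (walk-nothing G K m)) reach) λ ()
      ... | just t with nextB-just G step | j₀ ℕ.≟ suc k
      ...   | f , f∈ , src-f , _    | yes refl =
              contradiction (trans src-f vertex-last) (minus-e-from-v mpJ e∈J f∈)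
      ...   | f , f∈ , src-f , refl | no j₀≢   =
              stays-beyond later m (ℕ.m<n⇒m<1+n i<j₀) j₀< (trans (cong (walk G K m ∘ just) next≡) reach)
        where
        j₀< : j₀ < suc k
        j₀< = ℕ.≤∧≢⇒< j₀≤ j₀≢
        next≡ : vertex (suc j₀) ≡ tgt G f
        next≡ = just-injective (trans (sym (later i<j₀ j₀<)) (J-step-of j₀ f∈ src-f))

      leave : LeavesFrom J
      leave with last-failure (λ i → Maybe.≡-dec _≟_ (nextB G J (vertex i)) (just (vertex (suc i)))) (suc k)
      ... | inj₁ steps = ⊥-elim (not-all-steps steps)
      ... | inj₂ (i , i< , ¬step , later) with nextB-just G {B} (vertex-step i<)
      ...   | g , g∈B , src-g , tgt-g =
              swap-out mpJ e∈J (x∈p∧y∉p⇒x≢y g∈B e∉B) (loopless mpB g∈B) from-free into-free no-path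
        where
        from-free : NoEdgeFrom G K (src G g)
        from-free f∈ src-f =
          ¬step (trans (J-step-of i f∈ (trans src-f src-g)) (cong just (out-of-vertex i< (trans src-f src-g))))
        into-free : NoEdgeInto G K (tgt G g)
        into-free f∈ tgt-f =
          ¬step (trans (J-step-of i f∈ (into-vertex i< (trans tgt-f tgt-g))) (cong just (trans tgt-f tgt-g)))
        no-path : ¬ Path G K (tgt G g) (src G g)
        no-path (m , reach)
          with stays-beyond later m ℕ.≤-refl i< (trans (cong (walk G K m ∘ just) (sym tgt-g)) reach)
        ... | j , i<j , j≤ , src≡ with vertex-injective (ℕ.<⇒≤ i<) j≤ (trans (sym src-g) src≡)
        ...   | refl = ℕ.<-irrefl refl i<j

  exchange-out : ∀ {B J} → Multipath G B → ¬ Multipath G (B ∪ ⁅ e ⁆) → e ∉ B → Multipath G J → e ∈ J →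
                 ∃ λ J′ → Multipath G J′ × e ∉ J′ × ∣ J ∣ ≤ ∣ J′ ∣
  exchange-out {B} mpB stuck e∉B mpJ e∈J with nextB G B v in out
  ... | just _ with nextB-just G out
  ...   | h , h∈B , src-h , _ = leave-along-out-edge mpB e∉B h∈B src-h mpJ e∈J
  exchange-out {B} mpB stuck e∉B mpJ e∈J | nothing with any? (λ h → (h ∈? B) ×-dec (tgt G h ≟ w))
  ... | yes (h , h∈B , tgt-h) = leave-along-in-edge mpB e∉B h∈B tgt-h mpJ e∈J
  ... | no no-in with extend-or-Path G (nextB-nothing G out) mpB nl (¬∃⇒NoEdgeInto G no-in)
  ...   | inj₁ mp′            = ⊥-elim (stuck mp′)
  ...   | inj₂ (zero  , w≡v)  = contradiction w≡v no-trivial-path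
  ...   | inj₂ (suc k , path) = AlongPath.leave {k = k} mpB e∉B mpJ e∈J path

-- The Tutte polynomial

open import Data.Integer using (ℤ; 0ℤ; 1ℤ; _+_; _*_; _-_; _^_)
import Data.Integer.Properties as ℤ
open import Data.Integer.Tactic.RingSolver using (solve-∀)
import Algebra.Properties.CommutativeSemigroup as CommutativeSemigroupProperties

sumℤ : {A : Set} → (A → ℤ) → List A → ℤ
sumℤ F = foldr (λ a s → F a + s) 0ℤ

module _ {A : Set} where

  sumℤ-++ : ∀ (F : A → ℤ) xs ys → sumℤ F (xs ++ ys) ≡ sumℤ F xs + sumℤ F ys
  sumℤ-++ F []       ys = sym (ℤ.+-identityˡ _)
  sumℤ-++ F (x ∷ xs) ys = trans (cong (F x +_) (sumℤ-++ F xs ys)) (sym (ℤ.+-assoc (F x) _ _))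

  sumℤ-map : ∀ {B : Set} (F : B → ℤ) (g : A → B) xs → sumℤ F (map g xs) ≡ sumℤ (F ∘ g) xs
  sumℤ-map F g []       = refl
  sumℤ-map F g (x ∷ xs) = cong (F (g x) +_) (sumℤ-map F g xs)

  sumℤ-cong : ∀ {F G : A → ℤ} → (∀ a → F a ≡ G a) → ∀ xs → sumℤ F xs ≡ sumℤ G xs
  sumℤ-cong F≗G []       = refl
  sumℤ-cong F≗G (x ∷ xs) = cong₂ _+_ (F≗G x) (sumℤ-cong F≗G xs)

  sumℤ-+ : ∀ (F G : A → ℤ) xs → sumℤ (λ a → F a + G a) xs ≡ sumℤ F xs + sumℤ G xs
  sumℤ-+ F G []       = refl
  sumℤ-+ F G (x ∷ xs) = trans (cong (F x + G x +_) (sumℤ-+ F G xs))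
                              (interchange (F x) (G x) (sumℤ F xs) (sumℤ G xs))
    where open CommutativeSemigroupProperties ℤ.+-commutativeSemigroup using (interchange)

  sumℤ-*ˡ : ∀ c (F : A → ℤ) xs → sumℤ (λ a → c * F a) xs ≡ c * sumℤ F xs
  sumℤ-*ˡ c F []       = sym (ℤ.*-zeroʳ c)
  sumℤ-*ˡ c F (x ∷ xs) = trans (cong (c * F x +_) (sumℤ-*ˡ c F xs)) (sym (ℤ.*-distribˡ-+ c (F x) _))

sumℤ-subsets-suc : (F : Subset (suc n) → ℤ) →
  sumℤ F (subsets (suc n)) ≡ sumℤ (F ∘ (true ∷_)) (subsets n) + sumℤ (F ∘ (false ∷_)) (subsets n)
sumℤ-subsets-suc {n} F = trans (sumℤ-++ F (map (true ∷_) (subsets n)) _)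
  (cong₂ _+_ (sumℤ-map F (true ∷_) (subsets n)) (sumℤ-map F (false ∷_) (subsets n)))

sumℤ-subsets-insertAt : (e : Fin (suc n)) (F : Subset (suc n) → ℤ) →
  sumℤ F (subsets (suc n)) ≡ sumℤ (λ A → F (insertAt A e true) + F (insertAt A e false)) (subsets n)
sumℤ-subsets-insertAt {n} zero F =
  trans (sumℤ-subsets-suc F) (sym (sumℤ-+ (F ∘ (true ∷_)) (F ∘ (false ∷_)) (subsets n)))
sumℤ-subsets-insertAt {suc n} (suc e) F = begin
  sumℤ F (subsets (suc (suc n)))
    ≡⟨ sumℤ-subsets-suc F ⟩
  sumℤ (F ∘ (true ∷_)) (subsets (suc n)) + sumℤ (F ∘ (false ∷_)) (subsets (suc n))
    ≡⟨ cong₂ _+_ (sumℤ-subsets-insertAt e (F ∘ (true ∷_)))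
                 (sumℤ-subsets-insertAt e (F ∘ (false ∷_))) ⟩
  sumℤ (paired ∘ (true ∷_)) (subsets n) + sumℤ (paired ∘ (false ∷_)) (subsets n)
    ≡⟨ sumℤ-subsets-suc paired ⟨
  sumℤ paired (subsets (suc n)) ∎
  where
  open ≡-Reasoning
  paired : Subset (suc n) → ℤ
  paired A = F (insertAt A (suc e) true) + F (insertAt A (suc e) false)

tutteTerm : ∀ {n} → (Subset n → Bool) → ℤ → ℤ → Subset n → ℤ
tutteTerm indep x y A = (x - 1ℤ) ^ (rank indep ⊤ ∸ rank indep A) * (y - 1ℤ) ^ (∣ A ∣ ∸ rank indep A)

private
  monomial : ℤ → ℤ → ℕ → ℕ → ℤ
  monomial x y k l = (x - 1ℤ) ^ k * (y - 1ℤ) ^ l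

  monomial-sucˡ : ∀ x y k l → monomial x y (suc k) l ≡ (x - 1ℤ) * monomial x y k l
  monomial-sucˡ x y k l = ℤ.*-assoc (x - 1ℤ) _ _

  monomial-sucʳ : ∀ x y k l → monomial x y k (suc l) ≡ (y - 1ℤ) * monomial x y k l
  monomial-sucʳ x y k l = left-commute ((x - 1ℤ) ^ k) (y - 1ℤ) ((y - 1ℤ) ^ l)
    where
    left-commute : ∀ a b c → a * (b * c) ≡ b * (a * c)
    left-commute = solve-∀

  predecessor-*-+ : ∀ a t → (a - 1ℤ) * t + t ≡ a * t
  predecessor-*-+ = solve-∀

  tutteTerm-≡ : ∀ {n} (indep : Subset n → Bool) x y A {r s c} →
                rank indep ⊤ ≡ r → rank indep A ≡ s → ∣ A ∣ ≡ c →
                tutteTerm indep x y A ≡ monomial x y (r ∸ s) (c ∸ s)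
  tutteTerm-≡ indep x y A refl refl refl = refl

  suc-∸ : ∀ {m k} → k ≤ m → suc m ∸ k ≡ suc (m ∸ k)
  suc-∸ = ℕ.+-∸-assoc 1

module _ {n : ℕ} (indep : Subset (suc n) → Bool) (e : Fin (suc n)) (x y : ℤ) where

  private
    term⁺ term⁻ : Subset n → ℤ
    term⁺ A = tutteTerm indep x y (insertAt A e true)
    term⁻ A = tutteTerm indep x y (insertAt A e false)

    -- tutte indep x y unfolds to sumℤ (tutteTerm indep x y) (subsets (suc n)).
    tutte-split : tutte indep x y ≡ sumℤ (λ A → term⁺ A + term⁻ A) (subsets n)
    tutte-split = sumℤ-subsets-insertAt e (tutteTerm indep x y)

    rank⊤-via : (r : Subset n → ℕ) → (∀ A → rank indep (insertAt A e true) ≡ r A) → rank indep ⊤ ≡ r ⊤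
    rank⊤-via r r⁺ = trans (cong (rank indep) (sym (insertAt-⊤ e))) (r⁺ ⊤)

    term⁺≡ : ∀ A {r s} → rank indep ⊤ ≡ r → rank indep (insertAt A e true) ≡ s →
             term⁺ A ≡ monomial x y (r ∸ s) (suc ∣ A ∣ ∸ s)
    term⁺≡ A r⊤ rA = tutteTerm-≡ indep x y (insertAt A e true) r⊤ rA (∣insertAt-true∣ e A)

    term⁻≡ : ∀ A {r s} → rank indep ⊤ ≡ r → rank indep (insertAt A e false) ≡ s →
             term⁻ A ≡ monomial x y (r ∸ s) (∣ A ∣ ∸ s)
    term⁻≡ A r⊤ rA = tutteTerm-≡ indep x y (insertAt A e false) r⊤ rA (∣insertAt-false∣ e A)

  tutte-loop : ∀ indep′ → (∀ A → rank indep (insertAt A e true) ≡ rank indep′ A) →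
               (∀ A → rank indep (insertAt A e false) ≡ rank indep′ A) →
               tutte indep x y ≡ y * tutte indep′ x y
  tutte-loop indep′ r⁺ r⁻ = begin
    tutte indep x y                                     ≡⟨ tutte-split ⟩
    sumℤ (λ A → term⁺ A + term⁻ A) (subsets n)          ≡⟨ sumℤ-cong pair (subsets n) ⟩
    sumℤ (λ A → y * tutteTerm indep′ x y A) (subsets n) ≡⟨ sumℤ-*ˡ y (tutteTerm indep′ x y) (subsets n) ⟩
    y * tutte indep′ x y                                ∎
    where
    open ≡-Reasoning
    r⊤ : rank indep ⊤ ≡ rank indep′ ⊤
    r⊤ = rank⊤-via (rank indep′) r⁺
    pair : ∀ A → term⁺ A + term⁻ A ≡ y * tutteTerm indep′ x y A
    pair A = begin
      term⁺ A + term⁻ A                   ≡⟨ cong₂ _+_ (term⁺≡ A r⊤ (r⁺ A)) (term⁻≡ A r⊤ (r⁻ A)) ⟩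
      monomial x y k (suc ∣ A ∣ ∸ s) + t  ≡⟨ cong (λ l → monomial x y k l + t) (suc-∸ (rank≤∣A∣ indep′ A)) ⟩
      monomial x y k (suc (∣ A ∣ ∸ s)) + t ≡⟨ cong (_+ t) (monomial-sucʳ x y k (∣ A ∣ ∸ s)) ⟩
      (y - 1ℤ) * t + t                    ≡⟨ predecessor-*-+ y t ⟩
      y * t                               ∎
      where
      s k : ℕ
      s = rank indep′ A
      k = rank indep′ ⊤ ∸ s
      t : ℤ
      t = tutteTerm indep′ x y A

  tutte-coloop : ∀ indep′ → (∀ A → rank indep (insertAt A e true) ≡ suc (rank indep′ A)) →
                 (∀ A → rank indep (insertAt A e false) ≡ rank indep′ A) →
                 tutte indep x y ≡ x * tutte indep′ x y
  tutte-coloop indep′ r⁺ r⁻ = begin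
    tutte indep x y                                     ≡⟨ tutte-split ⟩
    sumℤ (λ A → term⁺ A + term⁻ A) (subsets n)          ≡⟨ sumℤ-cong pair (subsets n) ⟩
    sumℤ (λ A → x * tutteTerm indep′ x y A) (subsets n) ≡⟨ sumℤ-*ˡ x (tutteTerm indep′ x y) (subsets n) ⟩
    x * tutte indep′ x y                                ∎
    where
    open ≡-Reasoning
    r⊤ : rank indep ⊤ ≡ suc (rank indep′ ⊤)
    r⊤ = rank⊤-via (suc ∘ rank indep′) r⁺
    pair : ∀ A → term⁺ A + term⁻ A ≡ x * tutteTerm indep′ x y A
    pair A = begin
      term⁺ A + term⁻ A                    ≡⟨ cong₂ _+_ (term⁺≡ A r⊤ (r⁺ A)) (term⁻≡ A r⊤ (r⁻ A)) ⟩
      t + monomial x y (suc r ∸ s) l       ≡⟨ cong (λ k → t + monomial x y k l) (suc-∸ (rank-mono indep′ ⊆⊤)) ⟩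
      t + monomial x y (suc (r ∸ s)) l     ≡⟨ cong (t +_) (monomial-sucˡ x y (r ∸ s) l) ⟩
      t + (x - 1ℤ) * t                     ≡⟨ ℤ.+-comm t _ ⟩
      (x - 1ℤ) * t + t                     ≡⟨ predecessor-*-+ x t ⟩
      x * t                                ∎
      where
      r s l : ℕ
      r = rank indep′ ⊤
      s = rank indep′ A
      l = ∣ A ∣ ∸ s
      t : ℤ
      t = tutteTerm indep′ x y A

  tutte-deletion-contraction :
    ∀ indepᴰ indepᶜ → (∀ A → rank indep (insertAt A e false) ≡ rank indepᴰ A) →
    (∀ A → rank indep (insertAt A e true) ≡ suc (rank indepᶜ A)) → rank indep ⊤ ≡ rank indepᴰ ⊤ →
    tutte indep x y ≡ tutte indepᴰ x y + tutte indepᶜ x y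
  tutte-deletion-contraction indepᴰ indepᶜ r⁻ r⁺ r⊤ = begin
    tutte indep x y                                   ≡⟨ tutte-split ⟩
    sumℤ (λ A → term⁺ A + term⁻ A) (subsets n)        ≡⟨ sumℤ-cong pair (subsets n) ⟩
    sumℤ (λ A → tᴰ A + tᶜ A) (subsets n)              ≡⟨ sumℤ-+ tᴰ tᶜ (subsets n) ⟩
    tutte indepᴰ x y + tutte indepᶜ x y               ∎
    where
    open ≡-Reasoning
    tᴰ tᶜ : Subset n → ℤ
    tᴰ = tutteTerm indepᴰ x y
    tᶜ = tutteTerm indepᶜ x y
    pair : ∀ A → term⁺ A + term⁻ A ≡ tᴰ A + tᶜ A
    pair A = trans (ℤ.+-comm (term⁺ A) (term⁻ A))
      (cong₂ _+_ (term⁻≡ A r⊤ (r⁻ A)) (term⁺≡ A (rank⊤-via (suc ∘ rank indepᶜ) r⁺) (r⁺ A)))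

-- Multipath matroids

module _ {V E : ℕ} (G : Digraph V E) where

  independent⇔Multipath : ∀ {K} → Independent (M G) K ⇔ Multipath G K
  independent⇔Multipath = mk⇔ (isMultipath⇒Multipath G) (Multipath⇒isMultipath G)

  M-downClosed : DownClosed (M G)
  M-downClosed indA B⊆A = independent⇔Multipath .from (Multipath-⊆ G (independent⇔Multipath .to indA) B⊆A)

  M-independent-⊥ : Independent (M G) ⊥
  M-independent-⊥ = independent⇔Multipath .from (Multipath-⊥ G)

module _ {V E : ℕ} (G : Digraph (suc V) (suc E)) (e : Fin (suc E)) where

  private
    D : Digraph (suc V) E
    D = delete G e

  rank-delete : ∀ A → rank (M G) (insertAt A e false) ≡ rank (M D) A
  rank-delete = rank-insertAt-false (M G) e (M D) independence
    where
    independence : ∀ {B} → Independent (M G) (insertAt B e false) ⇔ Independent (M D) B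
    independence = ⇔.trans (independent⇔Multipath G)
                     (⇔.trans (⇔.sym (Multipath-delete G e)) (⇔.sym (independent⇔Multipath D)))

  rank-loop : IsMatroidLoop (M G) e → ∀ A → rank (M G) (insertAt A e true) ≡ rank (M D) A
  rank-loop loop A = trans (rank-insertAt-loop (M G) e (M-downClosed G) loop A) (rank-delete A)

  module _ (mpG : IsMPDigraph G) (nl : src G e ≢ tgt G e) where

    private
      C : Digraph V E
      C = contract G e nl

    rank-contract : ∀ A → rank (M G) (insertAt A e true) ≡ suc (rank (M C) A)
    rank-contract = rank-insertAt-true (M G) e (M C) (M-independent-⊥ C) independence exchangeIn
      where
      independence : ∀ {B} → Independent (M G) (insertAt B e true) ⇔ Independent (M C) B
      independence = ⇔.trans (independent⇔Multipath G)
                       (⇔.trans (⇔.sym (Multipath-contract G e nl)) (⇔.sym (independent⇔Multipath C)))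
      exchangeIn : ExchangeIn (M G) e
      exchangeIn indJ e∉J with exchange-in G mpG e nl (independent⇔Multipath G .to indJ) e∉J
      ... | J′ , mpJ′ , rest = J′ , independent⇔Multipath G .from mpJ′ , rest

    rank-coloop : IsMatroidColoop (M G) e → ∀ A → rank (M G) (insertAt A e false) ≡ rank (M C) A
    rank-coloop coloop A = ℕ.suc-injective (begin
      suc (rank (M G) (insertAt A e false)) ≡⟨ coloop-step ⟨
      rank (M G) (insertAt A e true)        ≡⟨ rank-contract A ⟩
      suc (rank (M C) A)                    ∎)
      where
      open ≡-Reasoning
      coloop-step : rank (M G) (insertAt A e true) ≡ suc (rank (M G) (insertAt A e false))
      coloop-step = rank-insertAt-coloop (M G) e (M-downClosed G) (M-independent-⊥ G) coloop A

    rank-⊤-delete : ¬ IsMatroidColoop (M G) e → rank (M G) ⊤ ≡ rank (M D) ⊤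
    rank-⊤-delete ¬coloop =
      trans (rank-⊤-noncoloop (M G) e (M-independent-⊥ G) exchangeOut ¬coloop) (rank-delete ⊤)
      where
      exchangeOut : ExchangeOut (M G) e
      exchangeOut {B} (indB , maximal) e∉B indJ e∈J
        with exchange-out G mpG e nl (independent⇔Multipath G .to indB) unextendable e∉B
                                     (independent⇔Multipath G .to indJ) e∈J
        where
        unextendable : ¬ Multipath G (B ∪ ⁅ e ⁆)
        unextendable mp′ =
          e∉B (subst (e ∈_) (maximal _ (independent⇔Multipath G .from mp′) (p⊆p∪⁅y⁆ B)) (y∈p∪⁅y⁆ B))
      ... | J′ , mpJ′ , rest = J′ , independent⇔Multipath G .from mpJ′ , rest

corollary5p5 : {V E : ℕ} (G : Digraph (suc V) (suc E)) (e : Fin (suc E)) →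
  IsMPDigraph G →
  (IsMatroidLoop (M G) e →
     (x y : ℤ) → T_M G x y ≡ y * T_M (delete G e) x y)
  × ((nl : src G e ≢ tgt G e) → IsMatroidColoop (M G) e →
     (x y : ℤ) → T_M G x y ≡ x * T_M (contract G e nl) x y)
  × ((nl : src G e ≢ tgt G e) → ¬ IsMatroidLoop (M G) e → ¬ IsMatroidColoop (M G) e →
     (x y : ℤ) → T_M G x y ≡ T_M (delete G e) x y + T_M (contract G e nl) x y)
corollary5p5 G e mpG =
    (λ loop x y → tutte-loop (M G) e x y (M (delete G e)) (rank-loop G e loop) (rank-delete G e))
  , (λ nl coloop x y →
       tutte-coloop (M G) e x y (M (contract G e nl)) (rank-contract G e mpG nl) (rank-coloop G e mpG nl coloop))
  , (λ nl _ ¬coloop x y →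
       tutte-deletion-contraction (M G) e x y (M (delete G e)) (M (contract G e nl))
         (rank-delete G e) (rank-contract G e mpG nl) (rank-⊤-delete G e mpG nl ¬coloop))
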